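{- Assume that $\delta \in \mathcal{S}_m$ and $\pi \in \mathcal{S}_n$ are two disjoint permutations, where $\operatorname{des}(\delta) = r$ and $\operatorname{des}(\pi) = s$. Moreover, $\delta_1<\delta_2$ and all of the elements of $\delta$ are larger than the elements of $\pi$. Then \begin{align*} (1)\ & \sum_{\substack{\alpha \in \mathrm{Sh}_l(\pi,\delta) \\ \operatorname{des}(\alpha) = d}} q^{\operatorname{maj}(\alpha)}= \genfrac{[}{]}{0pt}{}{m-r+s}{d-r} \genfrac{[}{]}{0pt}{}{n-s+r-1}{d-s-1}\, q^{\operatorname{maj}(\delta) + \operatorname{maj}(\pi) + (d - s)(d - r)},\\ (2)\ & \sum_{\substack{\alpha \in \mathrm{Sh}_{ls}(\pi,\delta) \\ \operatorname{des}(\alpha) = d}} q^{\operatorname{maj}(\alpha)}= \genfrac{[}{]}{0pt}{}{m-r+s-1}{d-r} \genfrac{[}{]}{0pt}{}{n-s+r-1}{d-s-1}\, q^{\operatorname{maj}(\delta) + \operatorname{maj}(\pi) + (d - s)(d - r)},\\ (3)\ & \sum_{\substack{\alpha \in \mathrm{Sh}_{ll}(\pi,\delta) \\ \operatorname{des}(\alpha) = d}} q^{\operatorname{maj}(\alpha)}= \genfrac{[}{]}{0pt}{}{m-r+s-1}{d-r} \genfrac{[}{]}{0pt}{}{n-s+r-1}{d-s-1}\, q^{\operatorname{maj}(\delta) + \operatorname{maj}(\pi) + (d- s+1)(d - r)}. \end{align*}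
   Context: $\mathcal{S}_n$ denotes the set of permutations of length $n$, i.e. words of $n$ distinct integers (not necessarily $\{1,\dots,n\}$); two such permutations are disjoint if they share no letter. For a word $\alpha$, $\operatorname{des}(\alpha)$ is the number of descents (indices $i$ with $\alpha_i>\alpha_{i+1}$) and $\operatorname{maj}(\alpha)$ is the sum of the descent indices. $\genfrac{[}{]}{0pt}{}{n}{m}=\frac{(1-q^n)(1-q^{n-1})\cdots(1-q^{n-m+1})}{(1-q^m)(1-q^{m-1})\cdots(1-q)}$ is the Gaussian polynomial. For disjoint $\pi=\pi_1\cdots\pi_n$ and $\delta=\delta_1\cdots\delta_m$, a shuffle is a word $\alpha=\alpha_1\cdots\alpha_{m+n}$ containing both $\pi$ and $\delta$ as subsequences. $\mathrm{Sh}_l(\pi,\delta)$ is the set of shuffles with $\alpha_1=\delta_1$; $\mathrm{Sh}_{ls}(\pi,\delta)$ those with $\alpha_1=\delta_1$ and $\alpha_{m+n}=\delta_m$ (last letter of $\delta$); $\mathrm{Sh}_{ll}(\pi,\delta)$ those with $\alpha_1=\delta_1$ and $\alpha_2=\delta_2$. -}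

module Defs where

open import Data.Bool using (Bool; true; false; _∧_; if_then_else_)
open import Data.Nat as ℕ using (ℕ; zero; suc; _∸_)
open import Data.Integer as ℤ using (ℤ; +_; -[1+_]; _-_; _*_; _^_; 1ℤ; 0ℤ)
open import Data.List using (List; []; _∷_; _++_; length; map; concatMap; filterᵇ; head; last; take; foldr)
open import Data.List.Relation.Binary.Sublist.DecPropositional ℤ._≟_ using (_⊆?_)
import Data.List.Properties as LP
import Data.Maybe.Properties as MP
open import Relation.Nullary using (does)

des : List ℤ → ℕ
des [] = 0
des (x ∷ []) = 0
des (x ∷ y ∷ t) = (if does (y ℤ.<? x) then 1 else 0) ℕ.+ des (y ∷ t)

majFrom : ℕ → List ℤ → ℕ
majFrom i [] = 0
majFrom i (x ∷ []) = 0
majFrom i (x ∷ y ∷ t) = (if does (y ℤ.<? x) then i else 0) ℕ.+ majFrom (suc i) (y ∷ t)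

-- major index (descent positions are 1-indexed)
maj : List ℤ → ℕ
maj = majFrom 1

words : List ℤ → ℕ → List (List ℤ)
words L zero = [] ∷ []
words L (suc k) = concatMap (λ a → map (a ∷_) (words L k)) L

isShuffle : List ℤ → List ℤ → List ℤ → Bool
isShuffle π δ α = does (length α ℕ.≟ (length δ ℕ.+ length π)) ∧ does (π ⊆? α) ∧ does (δ ⊆? α)

condL : List ℤ → List ℤ → Bool
condL δ α = does (MP.≡-dec ℤ._≟_ (head α) (head δ))

condLS : List ℤ → List ℤ → Bool
condLS δ α = condL δ α ∧ does (MP.≡-dec ℤ._≟_ (last α) (last δ))

condLL : List ℤ → List ℤ → Bool
condLL δ α = does (LP.≡-dec ℤ._≟_ (take 2 α) (take 2 δ))

-- Every shuffle only uses letters of π ++ δ, so enumerating words of length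
-- m+n over that alphabet enumerates all shuffles (each once).
shSum : (List ℤ → List ℤ → Bool) → List ℤ → List ℤ → ℕ → ℤ → ℤ
shSum cond π δ d q =
  foldr ℤ._+_ 0ℤ (map (λ α → q ^ maj α)
    (filterᵇ (λ α → isShuffle π δ α ∧ cond δ α ∧ does (des α ℕ.≟ d))
      (words (π ++ δ) (length π ℕ.+ length δ))))

-- Gaussian polynomial [N, k] evaluated at q, written as qbinNum / qbinDen:
--   numerator   (1-q^N)(1-q^{N-1})⋯(1-q^{N-k+1})   (k factors),
--   denominator (1-q^k)(1-q^{k-1})⋯(1-q).
-- For k < 0 the Gaussian polynomial is 0 (numerator 0, denominator 1).
-- For k > N the numerator contains the factor 1-q^0 = 0, as in the definition.
prodNum : ℕ → ℕ → ℤ → ℤ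
prodNum N zero q = 1ℤ
prodNum N (suc i) q = (1ℤ - q ^ (N ∸ i)) * prodNum N i q

prodDen : ℕ → ℤ → ℤ
prodDen zero q = 1ℤ
prodDen (suc j) q = (1ℤ - q ^ suc j) * prodDen j q

qbinNum : ℕ → ℤ → ℤ → ℤ
qbinNum N (+ k) q = prodNum N k q
qbinNum N -[1+ _ ] q = 0ℤ

qbinDen : ℤ → ℤ → ℤ
qbinDen (+ k) q = prodDen k q
qbinDen -[1+ _ ] q = 1ℤ

-- q^e for an integer exponent e.  Only used where e < 0 forces a vanishing
-- Gaussian factor in the same product, so the value for e < 0 is irrelevant.
powZ : ℤ → ℤ → ℤ
powZ q (+ e) = q ^ e
powZ q -[1+ _ ] = 0ℤ

-- Split the shuffles of π and δ according to the word supplying their first letter, and let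
-- δFirst π δ d and πFirst π δ d be the corresponding sums of q^maj over the shuffles with d
-- descents. Since maj (x ∷ β) = des (x ∷ β) + maj β, removing the first letter multiplies such a
-- sum by q^d and, when the first two letters form a descent, shifts d by one. Every letter of δ
-- exceeds every letter of π, so a letter of δ followed by one of π is always a descent and the
-- converse never is; hence δFirst π (x ∷ y ∷ δ) is determined by δFirst π (y ∷ δ) and
-- πFirst π (y ∷ δ), and πFirst (p ∷ p′ ∷ π) δ by πFirst (p′ ∷ π) δ and δFirst (p′ ∷ π) δ.
-- Both functions are products of two Gaussian coefficients and a power of q, and the recursion is
-- exactly the q-Pascal rule in one of the two factors. Sh_l is δFirst, Sh_ls is δFirst restricted
-- to the words ending with the last letter of δ, and, as δ₁ < δ₂, Sh_ll is q^d times δFirst π (δ₂ ∷ δ′).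

module Submission where

open import Data.Bool using (Bool; true; false; _∧_; if_then_else_)
open import Data.Empty using (⊥; ⊥-elim)
open import Data.Integer as ℤ using (ℤ; +_; 0ℤ; 1ℤ; _+_; _-_; _*_; _^_; _<_; _<?_; _≟_)
import Data.Integer.Properties as ℤₚ
open import Data.Integer.Tactic.RingSolver using (solve-∀)
open import Data.List using (List; []; _∷_; _++_; length; map; concatMap; filterᵇ; foldr; last; take)
import Data.List.Properties as Listₚ
open import Data.List.Membership.Propositional using (_∈_; _∉_)
open import Data.List.Membership.Propositional.Properties using (∈-++⁺ˡ; ∈-++⁺ʳ)
open import Data.List.Relation.Binary.Disjoint.Propositional using (Disjoint; contractₗ; contractᵣ)
open import Data.List.Relation.Binary.Sublist.DecPropositional _≟_ using (_⊆_; _⊆?_; []; _∷_; _∷ʳ_)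
open import Data.List.Relation.Binary.Sublist.Heterogeneous.Properties using (∷⁻)
open import Data.List.Relation.Unary.All as All using (All; []; _∷_)
open import Data.List.Relation.Unary.AllPairs using ([]; _∷_)
open import Data.List.Relation.Unary.Any using (here; there)
open import Data.List.Relation.Unary.Unique.Propositional using (Unique)
import Data.List.Relation.Unary.Unique.Propositional.Properties as Uniqueₚ
open import Data.Maybe using (Maybe; just)
import Data.Maybe.Properties as Maybeₚ
open import Data.Nat as ℕ using (ℕ; zero; suc; _∸_; _≤_; z≤n; s≤s)
import Data.Nat.Properties as ℕₚ
import Data.Nat.Tactic.RingSolver as ℕ-Solver
open import Data.Product using (Σ; _×_; _,_; proj₁)
open import Function using (_∘_)
open import Function.Bundles using (_⇔_; mk⇔)
open import Relation.Binary.PropositionalEquality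
open import Relation.Nullary using (¬_; Dec; yes; no; does)
open import Relation.Nullary.Decidable using (dec-true; dec-false; does-⇔)

open import Defs

infixl 5 _when_

_when_ : ℤ → Bool → ℤ
x when true  = x
x when false = 0ℤ

when-∧ : ∀ x a b → x when (a ∧ b) ≡ x when b when a
when-∧ x true  b = refl
when-∧ x false b = refl

∑ : {A : Set} → (A → ℤ) → List A → ℤ
∑ f []       = 0ℤ
∑ f (x ∷ xs) = f x + ∑ f xs

∑-cong : ∀ {A : Set} {f g : A → ℤ} → f ≗ g → ∀ xs → ∑ f xs ≡ ∑ g xs
∑-cong f≗g []       = refl
∑-cong f≗g (x ∷ xs) = cong₂ _+_ (f≗g x) (∑-cong f≗g xs)

∑-zero : ∀ {A : Set} (xs : List A) → ∑ (λ _ → 0ℤ) xs ≡ 0ℤ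
∑-zero []       = refl
∑-zero (x ∷ xs) = trans (ℤₚ.+-identityˡ _) (∑-zero xs)

∑-vanishes : ∀ {A : Set} {f : A → ℤ} {xs} → All (λ x → f x ≡ 0ℤ) xs → ∑ f xs ≡ 0ℤ
∑-vanishes []         = refl
∑-vanishes (fx≡0 ∷ h) = cong₂ _+_ fx≡0 (∑-vanishes h)

∑-++ : ∀ {A : Set} (f : A → ℤ) xs ys → ∑ f (xs ++ ys) ≡ ∑ f xs + ∑ f ys
∑-++ f []       ys = sym (ℤₚ.+-identityˡ _)
∑-++ f (x ∷ xs) ys = trans (cong (_+_ (f x)) (∑-++ f xs ys)) (sym (ℤₚ.+-assoc (f x) _ _))

∑-+ : ∀ {A : Set} (f g : A → ℤ) xs → ∑ (λ x → f x + g x) xs ≡ ∑ f xs + ∑ g xs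
∑-+ f g []       = refl
∑-+ f g (x ∷ xs) = trans (cong (_+_ (f x + g x)) (∑-+ f g xs)) (interchange (f x) (g x) (∑ f xs) (∑ g xs))
  where
  interchange : ∀ a b c d → a + b + (c + d) ≡ a + c + (b + d)
  interchange = solve-∀

∑-when : ∀ {A : Set} (f : A → ℤ) b xs → ∑ (λ x → f x when b) xs ≡ ∑ f xs when b
∑-when f true  xs = refl
∑-when f false xs = ∑-zero xs

∑-map : ∀ {A B : Set} (f : B → ℤ) (g : A → B) xs → ∑ f (map g xs) ≡ ∑ (f ∘ g) xs
∑-map f g []       = refl
∑-map f g (x ∷ xs) = cong (_+_ (f (g x))) (∑-map f g xs)

∑-concatMap : ∀ {A B : Set} (f : B → ℤ) (g : A → List B) xs → ∑ f (concatMap g xs) ≡ ∑ (∑ f ∘ g) xs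
∑-concatMap f g []       = refl
∑-concatMap f g (x ∷ xs) = trans (∑-++ f (g x) (concatMap g xs)) (cong (_+_ (∑ f (g x))) (∑-concatMap f g xs))

∑-map-cong : ∀ {A B : Set} {f g : B → ℤ} (h : A → B) → (∀ a → f (h a) ≡ g (h a)) → ∀ xs → ∑ f (map h xs) ≡ ∑ g (map h xs)
∑-map-cong h eq []       = refl
∑-map-cong h eq (x ∷ xs) = cong₂ _+_ (eq x) (∑-map-cong h eq xs)

∑-map₂-cong : ∀ {A : Set} {f g : List A → ℤ} x y → (∀ t → f (x ∷ y ∷ t) ≡ g (x ∷ y ∷ t)) → ∀ ts →
              ∑ f (map (x ∷_) (map (y ∷_) ts)) ≡ ∑ g (map (x ∷_) (map (y ∷_) ts))
∑-map₂-cong x y eq []       = refl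
∑-map₂-cong x y eq (t ∷ ts) = cong₂ _+_ (eq t) (∑-map₂-cong x y eq ts)

∑-map-∷-++ : ∀ {A : Set} (f : List A → ℤ) x ts us → ∑ f (map (x ∷_) (ts ++ us)) ≡ ∑ f (map (x ∷_) ts) + ∑ f (map (x ∷_) us)
∑-map-∷-++ f x ts us = trans (cong (∑ f) (Listₚ.map-++ (x ∷_) ts us)) (∑-++ f (map (x ∷_) ts) (map (x ∷_) us))

foldr-filterᵇ : ∀ {A : Set} (P : A → Bool) (f : A → ℤ) xs → foldr _+_ 0ℤ (map f (filterᵇ P xs)) ≡ ∑ (λ x → f x when P x) xs
foldr-filterᵇ P f []       = refl
foldr-filterᵇ P f (x ∷ xs) with P x
... | true  = cong (_+_ (f x)) (foldr-filterᵇ P f xs)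
... | false = trans (foldr-filterᵇ P f xs) (sym (ℤₚ.+-identityˡ _))

∑-indicator : ∀ {L} → Unique L → ∀ {p} → p ∈ L → ∀ X → ∑ (λ a → X when does (a ≟ p)) L ≡ X
∑-indicator {b ∷ L} (b∉L ∷ _) (here refl) X rewrite dec-true (b ≟ b) refl =
  trans (cong (_+_ X) (∑-vanishes (All.map off b∉L))) (ℤₚ.+-identityʳ X)
  where
  off : ∀ {a} → b ≢ a → X when does (a ≟ b) ≡ 0ℤ
  off b≢a rewrite dec-false (_ ≟ b) (b≢a ∘ sym) = refl
∑-indicator {b ∷ L} (b∉L ∷ uniq) {p} (there p∈L) X rewrite dec-false (b ≟ p) (λ { refl → All.lookup b∉L p∈L refl }) =
  trans (ℤₚ.+-identityˡ _) (∑-indicator uniq p∈L X)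

shuffles : {A : Set} → List A → List A → List (List A)
shuffles []       ys       = ys ∷ []
shuffles (x ∷ xs) []       = (x ∷ xs) ∷ []
shuffles (x ∷ xs) (y ∷ ys) = map (x ∷_) (shuffles xs (y ∷ ys)) ++ map (y ∷_) (shuffles (x ∷ xs) ys)

leftFirst : {A : Set} → List A → List A → List (List A)
leftFirst []       ys = []
leftFirst (x ∷ xs) ys = map (x ∷_) (shuffles xs ys)

rightFirst : {A : Set} → List A → List A → List (List A)
rightFirst xs []       = []
rightFirst xs (y ∷ ys) = map (y ∷_) (shuffles xs ys)

shuffles-[] : ∀ {A : Set} (xs : List A) → shuffles xs [] ≡ xs ∷ []
shuffles-[] []       = refl
shuffles-[] (x ∷ xs) = refl

∑-shuffles : ∀ {A : Set} (g : List A → ℤ) xs ys {k} → length xs ℕ.+ length ys ≡ suc k →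
             ∑ g (shuffles xs ys) ≡ ∑ g (leftFirst xs ys) + ∑ g (rightFirst xs ys)
∑-shuffles g []       (y ∷ ys) _ = sym (ℤₚ.+-identityˡ _)
∑-shuffles g (x ∷ xs) []       _ rewrite shuffles-[] xs = sym (ℤₚ.+-identityʳ _)
∑-shuffles g (x ∷ xs) (y ∷ ys) _ = ∑-++ g (map (x ∷_) (shuffles xs (y ∷ ys))) (map (y ∷_) (shuffles (x ∷ xs) ys))

⊆-skip : ∀ {a xs ys} → (∀ {t} → xs ≢ a ∷ t) → xs ⊆ a ∷ ys → xs ⊆ ys
⊆-skip _        (_ ∷ʳ xs⊆ys)    = xs⊆ys
⊆-skip xs≢a∷_  (refl ∷ xs⊆ys)  = ⊥-elim (xs≢a∷_ refl)

∉⇒≢∷ : ∀ {a : ℤ} {xs} → a ∉ xs → ∀ {t} → xs ≢ a ∷ t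
∉⇒≢∷ a∉xs refl = a∉xs (here refl)

length-disjoint-⊆ : ∀ {xs ys zs} → Disjoint xs ys → xs ⊆ zs → ys ⊆ zs → length xs ℕ.+ length ys ≤ length zs
length-disjoint-⊆ disj []             []             = z≤n
length-disjoint-⊆ disj (z ∷ʳ xs⊆zs)   (.z ∷ʳ ys⊆zs) = ℕₚ.m≤n⇒m≤1+n (length-disjoint-⊆ disj xs⊆zs ys⊆zs)
length-disjoint-⊆ disj (refl ∷ xs⊆zs) (_ ∷ʳ ys⊆zs)  = s≤s (length-disjoint-⊆ (contractₗ disj) xs⊆zs ys⊆zs)
length-disjoint-⊆ {xs} {y ∷ ys} {_ ∷ zs} disj (_ ∷ʳ xs⊆zs) (refl ∷ ys⊆zs) =
  subst (ℕ._≤ suc (length zs)) (sym (ℕₚ.+-suc (length xs) (length ys))) (s≤s (length-disjoint-⊆ (contractᵣ disj) xs⊆zs ys⊆zs))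
length-disjoint-⊆ disj (refl ∷ _)     (refl ∷ _)     = ⊥-elim (disj (here refl , here refl))

isShuffle-⇔ : ∀ {π δ α π′ δ′ α′} →
  (length α ≡ length δ ℕ.+ length π ⇔ length α′ ≡ length δ′ ℕ.+ length π′) → (π ⊆ α ⇔ π′ ⊆ α′) → (δ ⊆ α ⇔ δ′ ⊆ α′) →
  isShuffle π δ α ≡ isShuffle π′ δ′ α′
isShuffle-⇔ {π} {δ} {α} {π′} {δ′} {α′} len π⊆ δ⊆ = cong₂ _∧_
  (does-⇔ len (length α ℕ.≟ length δ ℕ.+ length π) (length α′ ℕ.≟ length δ′ ℕ.+ length π′))
  (cong₂ _∧_ (does-⇔ π⊆ (π ⊆? α) (π′ ⊆? α′)) (does-⇔ δ⊆ (δ ⊆? α) (δ′ ⊆? α′)))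

isShuffle-∷ˡ : ∀ a π δ β → a ∉ δ → isShuffle (a ∷ π) δ (a ∷ β) ≡ isShuffle π δ β
isShuffle-∷ˡ a π δ β a∉δ = isShuffle-⇔ {a ∷ π} {δ} {a ∷ β} {π} {δ} {β}
  (mk⇔ (λ e → ℕₚ.suc-injective (trans e (ℕₚ.+-suc (length δ) (length π))))
       (λ e → trans (cong suc e) (sym (ℕₚ.+-suc (length δ) (length π)))))
  (mk⇔ ∷⁻ (refl ∷_))
  (mk⇔ (⊆-skip (∉⇒≢∷ a∉δ)) (a ∷ʳ_))

isShuffle-∷ʳ : ∀ a π δ β → a ∉ π → isShuffle π (a ∷ δ) (a ∷ β) ≡ isShuffle π δ β
isShuffle-∷ʳ a π δ β a∉π = isShuffle-⇔ {π} {a ∷ δ} {a ∷ β} {π} {δ} {β}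
  (mk⇔ ℕₚ.suc-injective (cong suc))
  (mk⇔ (⊆-skip (∉⇒≢∷ a∉π)) (a ∷ʳ_))
  (mk⇔ ∷⁻ (refl ∷_))

does-∧-false : ∀ {A B C : Set} (a? : Dec A) (b? : Dec B) (c? : Dec C) → (A → B → C → ⊥) → does a? ∧ does b? ∧ does c? ≡ false
does-∧-false (no _)  _       _       _ = refl
does-∧-false (yes _) (no _)  _       _ = refl
does-∧-false (yes _) (yes _) (no _)  _ = refl
does-∧-false (yes a) (yes b) (yes c) f = ⊥-elim (f a b c)

isShuffle-∷-neither : ∀ a π δ β → Disjoint π δ → (∀ {t} → π ≢ a ∷ t) → (∀ {t} → δ ≢ a ∷ t) →
                      isShuffle π δ (a ∷ β) ≡ false
isShuffle-∷-neither a π δ β disj π≢a∷_ δ≢a∷_ =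
  does-∧-false (length (a ∷ β) ℕ.≟ length δ ℕ.+ length π) (π ⊆? a ∷ β) (δ ⊆? a ∷ β) λ len π⊆α δ⊆α →
  ℕₚ.<-irrefl (trans (ℕₚ.+-comm (length π) (length δ)) (sym len))
              (s≤s (length-disjoint-⊆ disj (⊆-skip π≢a∷_ π⊆α) (⊆-skip δ≢a∷_ δ⊆α)))

viaLeft : (List ℤ → ℤ) → List ℤ → List ℤ → ℤ → List ℤ → ℤ
viaLeft g []      δ a β = 0ℤ
viaLeft g (p ∷ π) δ a β = g (p ∷ β) when isShuffle π δ β when does (a ≟ p)

viaRight : (List ℤ → ℤ) → List ℤ → List ℤ → ℤ → List ℤ → ℤ
viaRight g π []      a β = 0ℤ
viaRight g π (x ∷ δ) a β = g (x ∷ β) when isShuffle π δ β when does (a ≟ x)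

isShuffle-∷ : ∀ g {π δ} → Disjoint π δ → ∀ a β →
              g (a ∷ β) when isShuffle π δ (a ∷ β) ≡ viaLeft g π δ a β + viaRight g π δ a β
isShuffle-∷ g {[]} {[]} disj a β = cong (g (a ∷ β) when_) (isShuffle-∷-neither a [] [] β disj (λ ()) (λ ()))
isShuffle-∷ g {[]} {x ∷ δ} disj a β with a ≟ x
... | yes refl = trans (cong (g (a ∷ β) when_) (isShuffle-∷ʳ a [] δ β λ ())) (sym (ℤₚ.+-identityˡ _))
... | no a≢x   = cong (g (a ∷ β) when_) (isShuffle-∷-neither a [] (x ∷ δ) β disj (λ ()) λ { refl → a≢x refl })
isShuffle-∷ g {p ∷ π} {[]} disj a β with a ≟ p
... | yes refl = trans (cong (g (a ∷ β) when_) (isShuffle-∷ˡ a π [] β λ ())) (sym (ℤₚ.+-identityʳ _))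
... | no a≢p   = cong (g (a ∷ β) when_) (isShuffle-∷-neither a (p ∷ π) [] β disj (λ { refl → a≢p refl }) λ ())
isShuffle-∷ g {p ∷ π} {x ∷ δ} disj a β with a ≟ p | a ≟ x
... | yes refl | yes refl = ⊥-elim (disj (here refl , here refl))
... | yes refl | no _     =
  trans (cong (g (a ∷ β) when_) (isShuffle-∷ˡ a π (x ∷ δ) β λ a∈x∷δ → disj (here refl , a∈x∷δ))) (sym (ℤₚ.+-identityʳ _))
... | no _     | yes refl =
  trans (cong (g (a ∷ β) when_) (isShuffle-∷ʳ a (p ∷ π) δ β λ a∈p∷π → disj (a∈p∷π , here refl))) (sym (ℤₚ.+-identityˡ _))
... | no a≢p   | no a≢x   =
  cong (g (a ∷ β) when_) (isShuffle-∷-neither a (p ∷ π) (x ∷ δ) β disj (λ { refl → a≢p refl }) λ { refl → a≢x refl })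

-- Split the words by their first letter: only the first letters of π and δ contribute
-- (isShuffle-∷), each exactly once as L has no repetitions (∑-indicator).
∑-words : ∀ {L} → Unique L → (g : List ℤ → ℤ) → ∀ k {π δ} → length π ℕ.+ length δ ≡ k →
          All (_∈ L) π → All (_∈ L) δ → Disjoint π δ →
          ∑ (λ α → g α when isShuffle π δ α) (words L k) ≡ ∑ g (shuffles π δ)
∑-words uniq g zero    {[]} {[]} _ _ _ _ = refl
∑-words {L} uniq g (suc k) {π} {δ} len π⊆L δ⊆L disj = begin
  ∑ h (concatMap (λ a → map (a ∷_) W) L)
    ≡⟨ ∑-concatMap h (λ a → map (a ∷_) W) L ⟩
  ∑ (λ a → ∑ h (map (a ∷_) W)) L
    ≡⟨ ∑-cong (λ a → trans (∑-map h (a ∷_) W) (∑-cong (isShuffle-∷ g disj a) W)) L ⟩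
  ∑ (λ a → ∑ (λ β → viaLeft g π δ a β + viaRight g π δ a β) W) L
    ≡⟨ ∑-cong (λ a → ∑-+ (viaLeft g π δ a) (viaRight g π δ a) W) L ⟩
  ∑ (λ a → ∑ (viaLeft g π δ a) W + ∑ (viaRight g π δ a) W) L
    ≡⟨ ∑-+ (λ a → ∑ (viaLeft g π δ a) W) (λ a → ∑ (viaRight g π δ a) W) L ⟩
  ∑ (λ a → ∑ (viaLeft g π δ a) W) L + ∑ (λ a → ∑ (viaRight g π δ a) W) L
    ≡⟨ cong₂ _+_ (fromLeft π len π⊆L disj) (fromRight δ len δ⊆L disj) ⟩
  ∑ g (leftFirst π δ) + ∑ g (rightFirst π δ)
    ≡⟨ ∑-shuffles g π δ len ⟨
  ∑ g (shuffles π δ) ∎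
  where
  open ≡-Reasoning
  W = words L k
  h = λ α → g α when isShuffle π δ α

  fromLeft : ∀ π → length π ℕ.+ length δ ≡ suc k → All (_∈ L) π → Disjoint π δ →
             ∑ (λ a → ∑ (viaLeft g π δ a) W) L ≡ ∑ g (leftFirst π δ)
  fromLeft []      _   _           _    = trans (∑-cong (λ _ → ∑-zero W) L) (∑-zero L)
  fromLeft (p ∷ π) len (p∈L ∷ π⊆L) disj = begin
    ∑ (λ a → ∑ (λ β → X β when does (a ≟ p)) W) L ≡⟨ ∑-cong (λ a → ∑-when X (does (a ≟ p)) W) L ⟩
    ∑ (λ a → ∑ X W when does (a ≟ p)) L           ≡⟨ ∑-indicator uniq p∈L (∑ X W) ⟩
    ∑ X W                                          ≡⟨ ∑-words uniq (g ∘ (p ∷_)) k (ℕₚ.suc-injective len) π⊆L δ⊆L (contractₗ disj) ⟩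
    ∑ (g ∘ (p ∷_)) (shuffles π δ)                  ≡⟨ ∑-map g (p ∷_) (shuffles π δ) ⟨
    ∑ g (leftFirst (p ∷ π) δ)                      ∎
    where X = λ β → g (p ∷ β) when isShuffle π δ β

  fromRight : ∀ δ → length π ℕ.+ length δ ≡ suc k → All (_∈ L) δ → Disjoint π δ →
              ∑ (λ a → ∑ (viaRight g π δ a) W) L ≡ ∑ g (rightFirst π δ)
  fromRight []      _   _           _    = trans (∑-cong (λ _ → ∑-zero W) L) (∑-zero L)
  fromRight (x ∷ δ) len (x∈L ∷ δ⊆L) disj = begin
    ∑ (λ a → ∑ (λ β → X β when does (a ≟ x)) W) L ≡⟨ ∑-cong (λ a → ∑-when X (does (a ≟ x)) W) L ⟩
    ∑ (λ a → ∑ X W when does (a ≟ x)) L           ≡⟨ ∑-indicator uniq x∈L (∑ X W) ⟩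
    ∑ X W                                          ≡⟨ ∑-words uniq (g ∘ (x ∷_)) k len′ π⊆L δ⊆L (contractᵣ disj) ⟩
    ∑ (g ∘ (x ∷_)) (shuffles π δ)                  ≡⟨ ∑-map g (x ∷_) (shuffles π δ) ⟨
    ∑ g (rightFirst π (x ∷ δ))                     ∎
    where
    X = λ β → g (x ∷ β) when isShuffle π δ β
    len′ = ℕₚ.suc-injective (trans (sym (ℕₚ.+-suc (length π) (length δ))) len)

last-∈ : ∀ {A : Set} (x : A) t → Σ A λ a → last (x ∷ t) ≡ just a × a ∈ x ∷ t
last-∈ x []      = x , refl , here refl
last-∈ x (y ∷ t) with last-∈ y t
... | a , last≡a , a∈ = a , last≡a , there a∈

last-disjoint : ∀ {A : Set} {p : A} {π x δ} → Disjoint (p ∷ π) (x ∷ δ) → last (p ∷ π) ≢ last (x ∷ δ)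
last-disjoint {p = p} {π} {x} {δ} disj last≡ with last-∈ p π | last-∈ x δ
... | a , la , a∈ | b , lb , b∈ = disj (a∈ , subst (_∈ x ∷ δ) (sym (Maybeₚ.just-injective (trans (sym la) (trans last≡ lb)))) b∈)

asc : List ℤ → ℕ
asc []          = 0
asc (x ∷ [])    = 0
asc (x ∷ y ∷ t) = (if does (y <? x) then 0 else 1) ℕ.+ asc (y ∷ t)

+-left-comm : ∀ a b c → a ℕ.+ (b ℕ.+ c) ≡ b ℕ.+ (a ℕ.+ c)
+-left-comm = ℕ-Solver.solve-∀

majFrom-suc : ∀ k β → majFrom (suc k) β ≡ des β ℕ.+ majFrom k β
majFrom-suc k []          = refl
majFrom-suc k (x ∷ [])    = refl
majFrom-suc k (x ∷ y ∷ t) with y <? x | majFrom-suc (suc k) (y ∷ t)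
... | yes _ | ih = cong suc (trans (cong (k ℕ.+_) ih) (+-left-comm k (des (y ∷ t)) (majFrom (suc k) (y ∷ t))))
... | no  _ | ih = ih

maj-∷ : ∀ x β → maj (x ∷ β) ≡ des (x ∷ β) ℕ.+ maj β
maj-∷ x []      = refl
maj-∷ x (y ∷ t) with y <? x
... | yes _ = cong suc (majFrom-suc 1 (y ∷ t))
... | no  _ = majFrom-suc 1 (y ∷ t)

length≡1+asc+des : ∀ x β → length (x ∷ β) ≡ suc (asc (x ∷ β) ℕ.+ des (x ∷ β))
length≡1+asc+des x []      = refl
length≡1+asc+des x (y ∷ t) with y <? x | length≡1+asc+des y t
... | yes _ | ih = cong suc (trans ih (sym (ℕₚ.+-suc (asc (y ∷ t)) (des (y ∷ t)))))
... | no  _ | ih = cong suc ih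

length∸des≡1+asc : ∀ x β → length (x ∷ β) ∸ des (x ∷ β) ≡ suc (asc (x ∷ β))
length∸des≡1+asc x β = trans (cong (_∸ des (x ∷ β)) (length≡1+asc+des x β)) (ℕₚ.m+n∸n≡m (suc (asc (x ∷ β))) (des (x ∷ β)))

des-ascent : ∀ {x y} t → ¬ y < x → des (x ∷ y ∷ t) ≡ des (y ∷ t)
des-ascent {x} {y} t y≮x with y <? x
... | yes y<x = ⊥-elim (y≮x y<x)
... | no  _   = refl

des-descent : ∀ {x y} t → y < x → des (x ∷ y ∷ t) ≡ suc (des (y ∷ t))
des-descent {x} {y} t y<x with y <? x
... | yes _   = refl
... | no  y≮x = ⊥-elim (y≮x y<x)

maj-∷-+ : ∀ x β m → des (x ∷ β) ℕ.+ (maj β ℕ.+ m) ≡ maj (x ∷ β) ℕ.+ m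
maj-∷-+ x β m = trans (sym (ℕₚ.+-assoc (des (x ∷ β)) (maj β) m)) (cong (ℕ._+ m) (sym (maj-∷ x β)))

+-maj-∷ : ∀ x β m → des (x ∷ β) ℕ.+ (m ℕ.+ maj β) ≡ m ℕ.+ maj (x ∷ β)
+-maj-∷ x β m = trans (+-left-comm (des (x ∷ β)) m (maj β)) (cong (m ℕ.+_) (sym (maj-∷ x β)))

asc-ascent : ∀ {x y} t → ¬ y < x → asc (x ∷ y ∷ t) ≡ suc (asc (y ∷ t))
asc-ascent {x} {y} t y≮x with y <? x
... | yes y<x = ⊥-elim (y≮x y<x)
... | no  _   = refl

-- Nδ true, Nδ false and Nπ are the paper's m − r + s, m − r + s − 1 and n − s + r − 1.
bonus : Bool → ℕ
bonus b = if b then 1 else 0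

Nδ : Bool → List ℤ → List ℤ → ℕ
Nδ b π δ = bonus b ℕ.+ asc δ ℕ.+ des π

Nπ : List ℤ → List ℤ → ℕ
Nπ π δ = asc π ℕ.+ des δ

Nδ-true≡ : ∀ π x δ → Nδ true π (x ∷ δ) ≡ length (x ∷ δ) ∸ des (x ∷ δ) ℕ.+ des π
Nδ-true≡ π x δ = cong (ℕ._+ des π) (sym (length∸des≡1+asc x δ))

Nδ-false≡ : ∀ π x δ → Nδ false π (x ∷ δ) ≡ length (x ∷ δ) ∸ des (x ∷ δ) ℕ.+ des π ∸ 1
Nδ-false≡ π x δ = cong (λ k → k ℕ.+ des π ∸ 1) (sym (length∸des≡1+asc x δ))

Nπ≡ : ∀ p π δ → Nπ (p ∷ π) δ ≡ length (p ∷ π) ∸ des (p ∷ π) ℕ.+ des δ ∸ 1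
Nπ≡ p π δ = cong (λ k → k ℕ.+ des δ ∸ 1) (sym (length∸des≡1+asc p π))

shift : (ℕ → ℤ) → ℕ → ℤ
shift F zero    = 0ℤ
shift F (suc d) = F d

module _ (q : ℤ) where

  gauss : ℕ → ℕ → ℤ
  gauss N       zero    = 1ℤ
  gauss zero    (suc k) = 0ℤ
  gauss (suc N) (suc k) = q ^ suc k * gauss N (suc k) + gauss N k

  gauss-vanishes : ∀ {N k} → N ℕ.< k → gauss N k ≡ 0ℤ
  gauss-vanishes {zero}  {suc k} _         = refl
  gauss-vanishes {suc N} {suc k} (s≤s N<k) = begin
    q ^ suc k * gauss N (suc k) + gauss N k ≡⟨ cong₂ (λ a b → q ^ suc k * a + b) (gauss-vanishes (ℕₚ.m<n⇒m<1+n N<k)) (gauss-vanishes N<k) ⟩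
    q ^ suc k * 0ℤ + 0ℤ                      ≡⟨ trans (ℤₚ.+-identityʳ _) (ℤₚ.*-zeroʳ (q ^ suc k)) ⟩
    0ℤ                                       ∎
    where open ≡-Reasoning

  gauss-diagonal : ∀ N → gauss N N ≡ 1ℤ
  gauss-diagonal zero    = refl
  gauss-diagonal (suc N) = begin
    q ^ suc N * gauss N (suc N) + gauss N N ≡⟨ cong₂ (λ a b → q ^ suc N * a + b) (gauss-vanishes (ℕₚ.n<1+n N)) (gauss-diagonal N) ⟩
    q ^ suc N * 0ℤ + 1ℤ                      ≡⟨ cong (_+ 1ℤ) (ℤₚ.*-zeroʳ (q ^ suc N)) ⟩
    1ℤ                                       ∎
    where open ≡-Reasoning

  prodNum-suc : ∀ N k → prodNum (suc N) (suc k) q ≡ (1ℤ - q ^ suc N) * prodNum N k q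
  prodNum-suc N zero    = refl
  prodNum-suc N (suc k) = trans (cong ((1ℤ - q ^ (N ∸ k)) *_) (prodNum-suc N k)) (*-left-comm (1ℤ - q ^ (N ∸ k)) (1ℤ - q ^ suc N) (prodNum N k q))
    where
    *-left-comm : ∀ a b c → a * (b * c) ≡ b * (a * c)
    *-left-comm = solve-∀

  prodNum-vanishes : ∀ {N k} → N ℕ.< k → prodNum N k q ≡ 0ℤ
  prodNum-vanishes {N} {suc k} N<1+k with N ℕ.≟ k
  ... | yes refl rewrite ℕₚ.n∸n≡0 N = ℤₚ.*-zeroˡ (prodNum N N q)
  ... | no  N≢k  = trans (cong ((1ℤ - q ^ (N ∸ k)) *_) (prodNum-vanishes (ℕₚ.≤∧≢⇒< (ℕₚ.≤-pred N<1+k) N≢k)))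
                         (ℤₚ.*-zeroʳ (1ℤ - q ^ (N ∸ k)))

  gauss*prodDen≡prodNum : ∀ N k → gauss N k * prodDen k q ≡ prodNum N k q
  gauss*prodDen≡prodNum N       zero    = refl
  gauss*prodDen≡prodNum zero    (suc k) = sym (prodNum-vanishes {zero} {suc k} (s≤s z≤n))
  gauss*prodDen≡prodNum (suc N) (suc k) = begin
    (Q * gauss N (suc k) + gauss N k) * ((1ℤ - Q) * prodDen k q)
      ≡⟨ distrib Q (gauss N (suc k)) (gauss N k) (prodDen k q) ⟩
    Q * (gauss N (suc k) * prodDen (suc k) q) + (1ℤ - Q) * (gauss N k * prodDen k q)
      ≡⟨ cong₂ (λ a b → Q * a + (1ℤ - Q) * b) (gauss*prodDen≡prodNum N (suc k)) (gauss*prodDen≡prodNum N k) ⟩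
    Q * ((1ℤ - q ^ (N ∸ k)) * P) + (1ℤ - Q) * P
      ≡⟨ telescope ⟩
    (1ℤ - q ^ suc N) * P
      ≡⟨ prodNum-suc N k ⟨
    prodNum (suc N) (suc k) q ∎
    where
    open ≡-Reasoning
    Q = q ^ suc k
    P = prodNum N k q
    distrib : ∀ Q a b D → (Q * a + b) * ((1ℤ - Q) * D) ≡ Q * (a * ((1ℤ - Q) * D)) + (1ℤ - Q) * (b * D)
    distrib = solve-∀
    collect : ∀ Q e P → Q * ((1ℤ - e) * P) + (1ℤ - Q) * P ≡ (1ℤ - Q * e) * P
    collect = solve-∀
    telescope : Q * ((1ℤ - q ^ (N ∸ k)) * P) + (1ℤ - Q) * P ≡ (1ℤ - q ^ suc N) * P
    telescope with k ℕ.≤? N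
    ... | yes k≤N = trans (collect Q (q ^ (N ∸ k)) P) (cong (λ e → (1ℤ - e) * P)
                      (trans (sym (ℤₚ.^-distribˡ-+-* q (suc k) (N ∸ k))) (cong (λ n → q ^ suc n) (ℕₚ.m+[n∸m]≡n k≤N))))
    ... | no  k≰N rewrite prodNum-vanishes (ℕₚ.≰⇒> k≰N) = annihilate Q (q ^ (N ∸ k)) (q ^ suc N)
      where
      annihilate : ∀ Q e f → Q * ((1ℤ - e) * 0ℤ) + (1ℤ - Q) * 0ℤ ≡ (1ℤ - f) * 0ℤ
      annihilate = solve-∀

  q^-merge : ∀ m n {o} → m ℕ.+ n ≡ o → q ^ m * q ^ n ≡ q ^ o
  q^-merge m n refl = sym (ℤₚ.^-distribˡ-+-* q m n)

  -- F d = [A, d − a]_q [B, d − b]_q q^(M + (d − b + 1)(d − a)) for d ≥ a, b, and F d = 0 below a or b.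
  record IsGaussProduct (F : ℕ → ℤ) (A B a b M : ℕ) : Set where
    field
      vanishes₁ : ∀ {d} → d ℕ.< a → F d ≡ 0ℤ
      vanishes₂ : ∀ {d} → d ℕ.< b → F d ≡ 0ℤ
      value     : ∀ i j → a ℕ.+ i ≡ b ℕ.+ j → F (a ℕ.+ i) ≡ gauss A i * gauss B j * q ^ (M ℕ.+ suc j ℕ.* i)

  IsGaussProduct-cong : ∀ {F G A A′ B B′ a a′ b M M′} → F ≗ G → A ≡ A′ → B ≡ B′ → a ≡ a′ → M ≡ M′ →
                        IsGaussProduct F A B a b M → IsGaussProduct G A′ B′ a′ b M′
  IsGaussProduct-cong F≗G refl refl refl refl h = record
    { vanishes₁ = λ d<a → trans (sym (F≗G _)) (vanishes₁ d<a)
    ; vanishes₂ = λ d<b → trans (sym (F≗G _)) (vanishes₂ d<b)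
    ; value     = λ i j e → trans (sym (F≗G _)) (value i j e)
    }
    where open IsGaussProduct h

  IsGaussProduct-shift : ∀ {F A B a b M} → IsGaussProduct F A B a b M → IsGaussProduct (shift F) A B (suc a) (suc b) M
  IsGaussProduct-shift h = record
    { vanishes₁ = λ { {zero} _ → refl ; {suc d} (s≤s d<a) → vanishes₁ d<a }
    ; vanishes₂ = λ { {zero} _ → refl ; {suc d} (s≤s d<b) → vanishes₂ d<b }
    ; value     = λ i j e → value i j (ℕₚ.suc-injective e)
    }
    where open IsGaussProduct h

  -- (j + 1) i − (i + 1) j = i − j = b − a
  IsGaussProduct-swap : ∀ {F A B a b K} → IsGaussProduct F A B a b (a ℕ.+ K) → IsGaussProduct F B A b a (b ℕ.+ K)
  IsGaussProduct-swap {F} {A} {B} {a} {b} {K} h = record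
    { vanishes₁ = vanishes₂
    ; vanishes₂ = vanishes₁
    ; value     = λ j i e → begin
        F (b ℕ.+ j)                                            ≡⟨ cong F e ⟩
        F (a ℕ.+ i)                                            ≡⟨ value i j (sym e) ⟩
        gauss A i * gauss B j * q ^ (a ℕ.+ K ℕ.+ suc j ℕ.* i)  ≡⟨ cong₂ _*_ (ℤₚ.*-comm (gauss A i) (gauss B j)) (cong (q ^_) (exponent e)) ⟩
        gauss B j * gauss A i * q ^ (b ℕ.+ K ℕ.+ suc i ℕ.* j)  ∎
    }
    where
    open IsGaussProduct h
    open ≡-Reasoning
    exponent : ∀ {i j} → b ℕ.+ j ≡ a ℕ.+ i → a ℕ.+ K ℕ.+ suc j ℕ.* i ≡ b ℕ.+ K ℕ.+ suc i ℕ.* j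
    exponent {i} {j} e = begin
      a ℕ.+ K ℕ.+ suc j ℕ.* i      ≡⟨ regroup a K i j ⟩
      (a ℕ.+ i) ℕ.+ (K ℕ.+ j ℕ.* i) ≡⟨ cong₂ ℕ._+_ (sym e) (cong (K ℕ.+_) (ℕₚ.*-comm j i)) ⟩
      (b ℕ.+ j) ℕ.+ (K ℕ.+ i ℕ.* j) ≡⟨ regroup b K j i ⟨
      b ℕ.+ K ℕ.+ suc i ℕ.* j      ∎
      where
      regroup : ∀ a K i j → a ℕ.+ K ℕ.+ suc j ℕ.* i ≡ (a ℕ.+ i) ℕ.+ (K ℕ.+ j ℕ.* i)
      regroup = ℕ-Solver.solve-∀

  -- The q-Pascal rule [A + 1, i] = q^i [A, i] + [A, i − 1] in the first factor.
  IsGaussProduct-+ : ∀ {X Y A B a b M} → IsGaussProduct X A B a b M → IsGaussProduct Y B A b (suc a) M →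
                     IsGaussProduct (λ d → q ^ d * (X d + Y d)) (suc A) B a b (a ℕ.+ M)
  IsGaussProduct-+ {X} {Y} {A} {B} {a} {b} {M} hX hY = record
    { vanishes₁ = λ d<a → vanish (X.vanishes₁ d<a) (Y.vanishes₂ (ℕₚ.m<n⇒m<1+n d<a))
    ; vanishes₂ = λ d<b → vanish (X.vanishes₂ d<b) (Y.vanishes₁ d<b)
    ; value     = value
    }
    where
    module X = IsGaussProduct hX
    module Y = IsGaussProduct hY
    open ≡-Reasoning

    vanish : ∀ {d} → X d ≡ 0ℤ → Y d ≡ 0ℤ → q ^ d * (X d + Y d) ≡ 0ℤ
    vanish {d} X≡0 Y≡0 = trans (cong₂ (λ u v → q ^ d * (u + v)) X≡0 Y≡0) (ℤₚ.*-zeroʳ (q ^ d))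

    value : ∀ i j → a ℕ.+ i ≡ b ℕ.+ j →
            q ^ (a ℕ.+ i) * (X (a ℕ.+ i) + Y (a ℕ.+ i)) ≡ gauss (suc A) i * gauss B j * q ^ (a ℕ.+ M ℕ.+ suc j ℕ.* i)
    value zero j e = begin
      q ^ (a ℕ.+ 0) * (X (a ℕ.+ 0) + Y (a ℕ.+ 0))
        ≡⟨ cong₂ (λ u v → q ^ (a ℕ.+ 0) * (u + v)) (X.value 0 j e) (Y.vanishes₂ (s≤s (ℕₚ.≤-reflexive (ℕₚ.+-identityʳ a)))) ⟩
      q ^ (a ℕ.+ 0) * (1ℤ * gauss B j * q ^ (M ℕ.+ suc j ℕ.* 0) + 0ℤ)
        ≡⟨ rearrange (q ^ (a ℕ.+ 0)) (gauss B j) (q ^ (M ℕ.+ suc j ℕ.* 0)) ⟩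
      1ℤ * gauss B j * (q ^ (a ℕ.+ 0) * q ^ (M ℕ.+ suc j ℕ.* 0))
        ≡⟨ cong (1ℤ * gauss B j *_) (q^-merge (a ℕ.+ 0) (M ℕ.+ suc j ℕ.* 0) (exponent a M j)) ⟩
      1ℤ * gauss B j * q ^ (a ℕ.+ M ℕ.+ suc j ℕ.* 0) ∎
      where
      rearrange : ∀ Q g P → Q * (1ℤ * g * P + 0ℤ) ≡ 1ℤ * g * (Q * P)
      rearrange = solve-∀
      exponent : ∀ a M j → a ℕ.+ 0 ℕ.+ (M ℕ.+ suc j ℕ.* 0) ≡ a ℕ.+ M ℕ.+ suc j ℕ.* 0
      exponent = ℕ-Solver.solve-∀
    value (suc i) j e = begin
      Q * (X (a ℕ.+ suc i) + Y (a ℕ.+ suc i))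
        ≡⟨ cong₂ (λ u v → Q * (u + v)) (X.value (suc i) j e) (trans (cong Y e) (Y.value j i (trans (sym e) (ℕₚ.+-suc a i)))) ⟩
      Q * (gauss A (suc i) * gauss B j * q ^ (M ℕ.+ suc j ℕ.* suc i) + gauss B j * gauss A i * q ^ (M ℕ.+ suc i ℕ.* j))
        ≡⟨ distribute Q (gauss A (suc i)) (gauss B j) (gauss A i) (q ^ (M ℕ.+ suc j ℕ.* suc i)) (q ^ (M ℕ.+ suc i ℕ.* j)) ⟩
      gauss A (suc i) * gauss B j * (Q * q ^ (M ℕ.+ suc j ℕ.* suc i)) + gauss A i * gauss B j * (Q * q ^ (M ℕ.+ suc i ℕ.* j))
        ≡⟨ cong₂ (λ u v → gauss A (suc i) * gauss B j * u + gauss A i * gauss B j * v)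
                 (trans (q^-merge (a ℕ.+ suc i) _ (exponent₁ a i M j)) (ℤₚ.^-distribˡ-+-* q (suc i) E))
                 (q^-merge (a ℕ.+ suc i) _ (exponent₂ a i M j)) ⟩
      gauss A (suc i) * gauss B j * (q ^ suc i * q ^ E) + gauss A i * gauss B j * q ^ E
        ≡⟨ collect (gauss A (suc i)) (gauss B j) (q ^ suc i) (q ^ E) (gauss A i) ⟩
      (q ^ suc i * gauss A (suc i) + gauss A i) * gauss B j * q ^ E ∎
      where
      Q = q ^ (a ℕ.+ suc i)
      E = a ℕ.+ M ℕ.+ suc j ℕ.* suc i
      distribute : ∀ Q g₁ h g₀ P₁ P₀ → Q * (g₁ * h * P₁ + h * g₀ * P₀) ≡ g₁ * h * (Q * P₁) + g₀ * h * (Q * P₀)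
      distribute = solve-∀
      collect : ∀ g₁ h S T g₀ → g₁ * h * (S * T) + g₀ * h * T ≡ (S * g₁ + g₀) * h * T
      collect = solve-∀
      exponent₁ : ∀ a i M j → a ℕ.+ suc i ℕ.+ (M ℕ.+ suc j ℕ.* suc i) ≡ suc i ℕ.+ (a ℕ.+ M ℕ.+ suc j ℕ.* suc i)
      exponent₁ = ℕ-Solver.solve-∀
      exponent₂ : ∀ a i M j → a ℕ.+ suc i ℕ.+ (M ℕ.+ suc i ℕ.* j) ≡ a ℕ.+ M ℕ.+ suc j ℕ.* suc i
      exponent₂ = ℕ-Solver.solve-∀

  IsGaussProduct-shift-+ : ∀ {X Y A B a b M} → IsGaussProduct X A B a b M → IsGaussProduct Y B A b (suc a) M →
                           IsGaussProduct (λ d → q ^ d * (shift X d + Y d)) A (suc B) (suc a) b (suc a ℕ.+ M)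
  IsGaussProduct-shift-+ {X} {Y} hX hY =
    IsGaussProduct-swap (IsGaussProduct-cong (λ d → cong (q ^ d *_) (ℤₚ.+-comm (Y d) (shift X d))) refl refl refl refl
                                             (IsGaussProduct-+ hY (IsGaussProduct-shift hX)))

  IsGaussProduct-point : ∀ {F n B M} → (∀ d → F d ≡ q ^ (n ℕ.+ M) when does (n ℕ.≟ d)) → IsGaussProduct F n B 0 n M
  IsGaussProduct-point {F} {n} {B} {M} F≡ = record
    { vanishes₁ = λ ()
    ; vanishes₂ = λ {d} d<n → trans (F≡ d) (cong (q ^ (n ℕ.+ M) when_) (dec-false (n ℕ.≟ d) λ n≡d → ℕₚ.<-irrefl (sym n≡d) d<n))
    ; value     = value
    }
    where
    open ≡-Reasoning
    value : ∀ i j → i ≡ n ℕ.+ j → F i ≡ gauss n i * gauss B j * q ^ (M ℕ.+ suc j ℕ.* i)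
    value i zero e rewrite trans e (ℕₚ.+-identityʳ n) = begin
      F n                                  ≡⟨ F≡ n ⟩
      q ^ (n ℕ.+ M) when does (n ℕ.≟ n)     ≡⟨ cong (q ^ (n ℕ.+ M) when_) (dec-true (n ℕ.≟ n) refl) ⟩
      q ^ (n ℕ.+ M)                        ≡⟨ cong (q ^_) (exponent n M) ⟩
      q ^ (M ℕ.+ 1 ℕ.* n)                  ≡⟨ ℤₚ.*-identityˡ _ ⟨
      1ℤ * 1ℤ * q ^ (M ℕ.+ 1 ℕ.* n)         ≡⟨ cong (λ g → g * 1ℤ * q ^ (M ℕ.+ 1 ℕ.* n)) (gauss-diagonal n) ⟨
      gauss n n * 1ℤ * q ^ (M ℕ.+ 1 ℕ.* n) ∎
      where
      exponent : ∀ n M → n ℕ.+ M ≡ M ℕ.+ 1 ℕ.* n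
      exponent = ℕ-Solver.solve-∀
    value i (suc j) e = begin
      F i                                            ≡⟨ F≡ i ⟩
      q ^ (n ℕ.+ M) when does (n ℕ.≟ i)               ≡⟨ cong (q ^ (n ℕ.+ M) when_) (dec-false (n ℕ.≟ i) λ n≡i → ℕₚ.<-irrefl n≡i n<i) ⟩
      0ℤ                                             ≡⟨ annihilate (gauss B (suc j)) (q ^ (M ℕ.+ suc (suc j) ℕ.* i)) ⟨
      0ℤ * gauss B (suc j) * q ^ (M ℕ.+ suc (suc j) ℕ.* i) ≡⟨ cong (λ g → g * gauss B (suc j) * q ^ (M ℕ.+ suc (suc j) ℕ.* i)) (gauss-vanishes n<i) ⟨
      gauss n i * gauss B (suc j) * q ^ (M ℕ.+ suc (suc j) ℕ.* i) ∎
      where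
      n<i : n ℕ.< i
      n<i = subst (n ℕ.<_) (sym e) (ℕₚ.m<m+n n (s≤s z≤n))
      annihilate : ∀ g P → 0ℤ * g * P ≡ 0ℤ
      annihilate = solve-∀

  IsGaussProduct-zero : ∀ {F n B M} → (∀ d → F d ≡ 0ℤ) → IsGaussProduct F n B 0 (suc n) M
  IsGaussProduct-zero {F} {n} {B} {M} F≡0 = record
    { vanishes₁ = λ ()
    ; vanishes₂ = λ {d} _ → F≡0 d
    ; value     = λ i j e → begin
        F i                                      ≡⟨ F≡0 i ⟩
        0ℤ                                       ≡⟨ annihilate (gauss B j) (q ^ (M ℕ.+ suc j ℕ.* i)) ⟨
        0ℤ * gauss B j * q ^ (M ℕ.+ suc j ℕ.* i)   ≡⟨ cong (λ g → g * gauss B j * q ^ (M ℕ.+ suc j ℕ.* i)) (gauss-vanishes (n<i e)) ⟨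
        gauss n i * gauss B j * q ^ (M ℕ.+ suc j ℕ.* i) ∎
    }
    where
    open ≡-Reasoning
    n<i : ∀ {i j} → i ≡ suc n ℕ.+ j → n ℕ.< i
    n<i {j = j} e = subst (n ℕ.<_) (sym e) (s≤s (ℕₚ.m≤m+n n j))
    annihilate : ∀ g P → 0ℤ * g * P ≡ 0ℤ
    annihilate = solve-∀

  qbinNum-negative : ∀ N {d r} → d ℕ.< r → qbinNum N (+ d - + r) q ≡ 0ℤ
  qbinNum-negative N {d} {r} d<r rewrite ℤₚ.m-n≡m⊖n d r | ℤₚ.⊖-< d<r with r ∸ d | ℕₚ.m>n⇒m∸n≢0 d<r
  ... | zero  | r∸d≢0 = ⊥-elim (r∸d≢0 refl)
  ... | suc _ | _     = refl

  qbinomial-form : ∀ {F : ℕ → ℤ} {A B r s M} e →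
    (∀ {d} → d ℕ.< r → F d ≡ 0ℤ) → (∀ {d} → d ℕ.< suc s → F d ≡ 0ℤ) →
    (∀ i j → r ℕ.+ i ≡ suc s ℕ.+ j → F (r ℕ.+ i) ≡ gauss A i * gauss B j * q ^ (M ℕ.+ (e ℕ.+ suc j) ℕ.* i)) →
    ∀ d → F d * qbinDen (+ d - + r) q * qbinDen (+ d - + s - + 1) q
          ≡ qbinNum A (+ d - + r) q * qbinNum B (+ d - + s - + 1) q * q ^ M * powZ q ((+ d - + s + + e) * (+ d - + r))
  qbinomial-form {F} {A} {B} {r} {s} {M} e vanishes₁ vanishes₂ value d = cases (d ℕ.<? r) (d ℕ.<? suc s)
    where
    open ≡-Reasoning
    D₁ = qbinDen (+ d - + r) q
    D₂ = qbinDen (+ d - + s - + 1) q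
    N₁ = qbinNum A (+ d - + r) q
    N₂ = qbinNum B (+ d - + s - + 1) q
    W  = powZ q ((+ d - + s + + e) * (+ d - + r))

    minus-suc : + d - + s - + 1 ≡ + d - + suc s
    minus-suc = regroup (+ d) (+ s)
      where
      regroup : ∀ x y → x - y - 1ℤ ≡ x - (1ℤ + y)
      regroup = solve-∀

    both-vanish : F d ≡ 0ℤ → N₁ * N₂ ≡ 0ℤ → F d * D₁ * D₂ ≡ N₁ * N₂ * q ^ M * W
    both-vanish F≡0 N₁N₂≡0 = begin
      F d * D₁ * D₂       ≡⟨ cong (λ x → x * D₁ * D₂) F≡0 ⟩
      0ℤ * D₁ * D₂        ≡⟨ annihilate D₁ D₂ ⟩
      0ℤ                  ≡⟨ annihilate (q ^ M) W ⟨
      0ℤ * q ^ M * W      ≡⟨ cong (λ x → x * q ^ M * W) N₁N₂≡0 ⟨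
      N₁ * N₂ * q ^ M * W ∎
      where
      annihilate : ∀ x y → 0ℤ * x * y ≡ 0ℤ
      annihilate = solve-∀

    positive : ¬ d ℕ.< r → ¬ d ℕ.< suc s → F d * D₁ * D₂ ≡ N₁ * N₂ * q ^ M * W
    positive d≮r d≮1+s = begin
      F d * D₁ * D₂
        ≡⟨ cong (λ x → x * D₁ * D₂) F≡ ⟩
      gauss A i * gauss B j * q ^ (M ℕ.+ E) * D₁ * D₂
        ≡⟨ cong₂ (λ k l → gauss A i * gauss B j * q ^ (M ℕ.+ E) * qbinDen k q * qbinDen l q) k₁ k₂ ⟩
      gauss A i * gauss B j * q ^ (M ℕ.+ E) * prodDen i q * prodDen j q
        ≡⟨ cong (λ x → gauss A i * gauss B j * x * prodDen i q * prodDen j q) (ℤₚ.^-distribˡ-+-* q M E) ⟩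
      gauss A i * gauss B j * (q ^ M * q ^ E) * prodDen i q * prodDen j q
        ≡⟨ regroup (gauss A i) (gauss B j) (q ^ M) (q ^ E) (prodDen i q) (prodDen j q) ⟩
      gauss A i * prodDen i q * (gauss B j * prodDen j q) * q ^ M * q ^ E
        ≡⟨ cong₂ (λ x y → x * y * q ^ M * q ^ E) (gauss*prodDen≡prodNum A i) (gauss*prodDen≡prodNum B j) ⟩
      prodNum A i q * prodNum B j q * q ^ M * powZ q (+ E)
        ≡⟨ cong (λ w → prodNum A i q * prodNum B j q * q ^ M * powZ q w) exponent ⟨
      prodNum A i q * prodNum B j q * q ^ M * W
        ≡⟨ cong₂ (λ k l → qbinNum A k q * qbinNum B l q * q ^ M * W) k₁ k₂ ⟨
      N₁ * N₂ * q ^ M * W ∎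
      where
      r≤d = ℕₚ.≮⇒≥ d≮r
      1+s≤d = ℕₚ.≮⇒≥ d≮1+s
      i = d ∸ r
      j = d ∸ suc s
      E = (e ℕ.+ suc j) ℕ.* i
      k₁ : + d - + r ≡ + i
      k₁ = trans (ℤₚ.m-n≡m⊖n d r) (ℤₚ.⊖-≥ r≤d)
      k₂ : + d - + s - + 1 ≡ + j
      k₂ = trans minus-suc (trans (ℤₚ.m-n≡m⊖n d (suc s)) (ℤₚ.⊖-≥ 1+s≤d))
      F≡ : F d ≡ gauss A i * gauss B j * q ^ (M ℕ.+ E)
      F≡ = trans (cong F (sym (ℕₚ.m+[n∸m]≡n r≤d))) (value i j (trans (ℕₚ.m+[n∸m]≡n r≤d) (sym (ℕₚ.m+[n∸m]≡n 1+s≤d))))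
      exponent : (+ d - + s + + e) * (+ d - + r) ≡ + E
      exponent = trans (cong₂ _*_ (trans (shuffle (+ d) (+ s) (+ e)) (cong (λ x → + e + (1ℤ + x)) k₂)) k₁) (sym (ℤₚ.pos-* (e ℕ.+ suc j) i))
        where
        shuffle : ∀ x y z → x - y + z ≡ z + (1ℤ + (x - y - 1ℤ))
        shuffle = solve-∀
      regroup : ∀ a b m x u v → a * b * (m * x) * u * v ≡ a * u * (b * v) * m * x
      regroup = solve-∀

    cases : Dec (d ℕ.< r) → Dec (d ℕ.< suc s) → F d * D₁ * D₂ ≡ N₁ * N₂ * q ^ M * W
    cases (yes d<r) _           = both-vanish (vanishes₁ d<r) (trans (cong (_* N₂) (qbinNum-negative A d<r)) (ℤₚ.*-zeroˡ N₂))
    cases (no _)    (yes d<1+s) = both-vanish (vanishes₂ d<1+s)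
      (trans (cong (N₁ *_) (trans (cong (λ k → qbinNum B k q) minus-suc) (qbinNum-negative B d<1+s))) (ℤₚ.*-zeroʳ N₁))
    cases (no d≮r)  (no d≮1+s)  = positive d≮r d≮1+s

  IsGaussProduct⇒qbinomial : ∀ {F A B r s M} → IsGaussProduct F A B r (suc s) M → ∀ d →
    F d * qbinDen (+ d - + r) q * qbinDen (+ d - + s - + 1) q
      ≡ qbinNum A (+ d - + r) q * qbinNum B (+ d - + s - + 1) q * q ^ M * powZ q ((+ d - + s) * (+ d - + r))
  IsGaussProduct⇒qbinomial {F} {A} {B} {r} {s} {M} h d =
    trans (qbinomial-form {M = M} 0 vanishes₁ vanishes₂ value d)
          (cong (λ k → qbinNum A (+ d - + r) q * qbinNum B (+ d - + s - + 1) q * q ^ M * powZ q (k * (+ d - + r)))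
                (ℤₚ.+-identityʳ (+ d - + s)))
    where open IsGaussProduct h

  IsGaussProduct⇒qbinomial-q^d : ∀ {F A B r s M} → IsGaussProduct F A B r (suc s) M → ∀ d →
    q ^ d * F d * qbinDen (+ d - + r) q * qbinDen (+ d - + s - + 1) q
      ≡ qbinNum A (+ d - + r) q * qbinNum B (+ d - + s - + 1) q * q ^ (r ℕ.+ M) * powZ q ((+ d - + s + + 1) * (+ d - + r))
  IsGaussProduct⇒qbinomial-q^d {F} {A} {B} {r} {s} {M} h =
    qbinomial-form {M = r ℕ.+ M} 1 (λ {d} d<r → trans (cong (q ^ d *_) (vanishes₁ d<r)) (ℤₚ.*-zeroʳ (q ^ d)))
                     (λ {d} d≤s → trans (cong (q ^ d *_) (vanishes₂ d≤s)) (ℤₚ.*-zeroʳ (q ^ d)))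
                     λ i j e → begin
                       q ^ (r ℕ.+ i) * F (r ℕ.+ i)
                         ≡⟨ cong (q ^ (r ℕ.+ i) *_) (value i j e) ⟩
                       q ^ (r ℕ.+ i) * (gauss A i * gauss B j * q ^ (M ℕ.+ suc j ℕ.* i))
                         ≡⟨ rearrange (q ^ (r ℕ.+ i)) (gauss A i) (gauss B j) (q ^ (M ℕ.+ suc j ℕ.* i)) ⟩
                       gauss A i * gauss B j * (q ^ (r ℕ.+ i) * q ^ (M ℕ.+ suc j ℕ.* i))
                         ≡⟨ cong (gauss A i * gauss B j *_) (q^-merge (r ℕ.+ i) (M ℕ.+ suc j ℕ.* i) (exponent r i M j)) ⟩
                       gauss A i * gauss B j * q ^ (r ℕ.+ M ℕ.+ (1 ℕ.+ suc j) ℕ.* i) ∎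
    where
    open IsGaussProduct h
    open ≡-Reasoning
    rearrange : ∀ Q a b P → Q * (a * b * P) ≡ a * b * (Q * P)
    rearrange = solve-∀
    exponent : ∀ r i M j → r ℕ.+ i ℕ.+ (M ℕ.+ suc j ℕ.* i) ≡ r ℕ.+ M ℕ.+ (1 ℕ.+ suc j) ℕ.* i
    exponent = ℕ-Solver.solve-∀

  qMaj : (List ℤ → Bool) → ℕ → List ℤ → ℤ
  qMaj P d α = q ^ maj α when (P α ∧ does (des α ℕ.≟ d))

  qMaj-cong : ∀ P P′ {d} α → P α ≡ P′ α → qMaj P d α ≡ qMaj P′ d α
  qMaj-cong P P′ {d} α = cong (λ b → q ^ maj α when (b ∧ does (des α ℕ.≟ d)))

  when-des : ∀ b {k d} (k≟d : Dec (k ≡ d)) m → q ^ (k ℕ.+ m) when (b ∧ does k≟d) ≡ q ^ d * (q ^ m when (b ∧ does k≟d))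
  when-des true  {k} (yes refl) m = ℤₚ.^-distribˡ-+-* q k m
  when-des true  {d = d} (no _) m = sym (ℤₚ.*-zeroʳ (q ^ d))
  when-des false {d = d} _      m = sym (ℤₚ.*-zeroʳ (q ^ d))

  when-suc : ∀ b k X d → X when (b ∧ does (suc k ℕ.≟ d)) ≡ shift (λ e → X when (b ∧ does (k ℕ.≟ e))) d
  when-suc true  k X zero    = refl
  when-suc false k X zero    = refl
  when-suc b     k X (suc d) = refl

  -- The shuffles are counted subject to a condition on their last letter: none for Sh_l,
  -- being the last letter of δ for Sh_ls.
  module _ (test : Maybe ℤ → Bool) where

    weight : ℕ → List ℤ → ℤ
    weight = qMaj (test ∘ last)

    weight-∷ : ∀ {b} x y t d → test (last (y ∷ t)) ≡ b →
               weight d (x ∷ y ∷ t) ≡ q ^ (des (x ∷ y ∷ t) ℕ.+ maj (y ∷ t)) when (b ∧ does (des (x ∷ y ∷ t) ℕ.≟ d))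
    weight-∷ x y t d refl = cong (λ m → q ^ m when (test (last (y ∷ t)) ∧ does (des (x ∷ y ∷ t) ℕ.≟ d))) (maj-∷ x (y ∷ t))

    weight-ascent : ∀ {x y} t d → ¬ y < x → weight d (x ∷ y ∷ t) ≡ q ^ d * weight d (y ∷ t)
    weight-ascent {x} {y} t d y≮x = begin
      weight d (x ∷ y ∷ t)
        ≡⟨ weight-∷ x y t d refl ⟩
      q ^ (des (x ∷ y ∷ t) ℕ.+ maj β) when (test (last β) ∧ does (des (x ∷ y ∷ t) ℕ.≟ d))
        ≡⟨ cong (λ k → q ^ (k ℕ.+ maj β) when (test (last β) ∧ does (k ℕ.≟ d))) (des-ascent t y≮x) ⟩
      q ^ (des β ℕ.+ maj β) when (test (last β) ∧ does (des β ℕ.≟ d))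
        ≡⟨ when-des (test (last β)) (des β ℕ.≟ d) (maj β) ⟩
      q ^ d * weight d β ∎
      where
      open ≡-Reasoning
      β = y ∷ t

    weight-descent : ∀ {x y} t d → y < x → weight d (x ∷ y ∷ t) ≡ q ^ d * shift (λ e → weight e (y ∷ t)) d
    weight-descent {x} {y} t d y<x = begin
      weight d (x ∷ y ∷ t)
        ≡⟨ weight-∷ x y t d refl ⟩
      q ^ (des (x ∷ y ∷ t) ℕ.+ maj β) when (test (last β) ∧ does (des (x ∷ y ∷ t) ℕ.≟ d))
        ≡⟨ cong (λ k → q ^ (k ℕ.+ maj β) when (test (last β) ∧ does (k ℕ.≟ d))) (des-descent t y<x) ⟩
      q ^ (suc (des β) ℕ.+ maj β) when (test (last β) ∧ does (suc (des β) ℕ.≟ d))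
        ≡⟨ when-des (test (last β)) (suc (des β) ℕ.≟ d) (maj β) ⟩
      q ^ d * (q ^ maj β when (test (last β) ∧ does (suc (des β) ℕ.≟ d)))
        ≡⟨ cong (q ^ d *_) (when-suc (test (last β)) (des β) (q ^ maj β) d) ⟩
      q ^ d * shift (λ e → weight e β) d ∎
      where
      open ≡-Reasoning
      β = y ∷ t

    ∑-ascent : ∀ {x y} L d → ¬ y < x → ∑ (weight d) (map (x ∷_) (map (y ∷_) L)) ≡ q ^ d * ∑ (weight d) (map (y ∷_) L)
    ∑-ascent []      d _   = sym (ℤₚ.*-zeroʳ (q ^ d))
    ∑-ascent {x} {y} (t ∷ L) d y≮x =
      trans (cong₂ _+_ (weight-ascent t d y≮x) (∑-ascent L d y≮x)) (sym (ℤₚ.*-distribˡ-+ (q ^ d) (weight d (y ∷ t)) _))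

    ∑-descent : ∀ {x y} L d → y < x → ∑ (weight d) (map (x ∷_) (map (y ∷_) L)) ≡ q ^ d * shift (λ e → ∑ (weight e) (map (y ∷_) L)) d
    ∑-descent []      zero    _   = refl
    ∑-descent []      (suc d) _   = sym (ℤₚ.*-zeroʳ (q ^ suc d))
    ∑-descent {x} {y} (t ∷ L) d y<x = trans (cong₂ _+_ (weight-descent t d y<x) (∑-descent L d y<x))
      (trans (sym (ℤₚ.*-distribˡ-+ (q ^ d) (shift (λ e → weight e (y ∷ t)) d) _)) (cong (q ^ d *_) (shift-+ d)))
      where
      shift-+ : ∀ d → shift (λ e → weight e (y ∷ t)) d + shift (λ e → ∑ (weight e) (map (y ∷_) L)) d
                      ≡ shift (λ e → weight e (y ∷ t) + ∑ (weight e) (map (y ∷_) L)) d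
      shift-+ zero    = refl
      shift-+ (suc d) = refl

    δFirst : List ℤ → List ℤ → ℕ → ℤ
    δFirst π δ d = ∑ (weight d) (rightFirst π δ)

    πFirst : List ℤ → List ℤ → ℕ → ℤ
    πFirst π δ d = ∑ (weight d) (leftFirst π δ)

    δFirst-ascent : ∀ {p x y} π δ → p < x → ¬ y < x → ∀ d →
                    q ^ d * (δFirst (p ∷ π) (y ∷ δ) d + shift (πFirst (p ∷ π) (y ∷ δ)) d) ≡ δFirst (p ∷ π) (x ∷ y ∷ δ) d
    δFirst-ascent {p} {x} {y} π δ p<x y≮x d = sym (begin
      δFirst (p ∷ π) (x ∷ y ∷ δ) d
        ≡⟨ ∑-map-∷-++ (weight d) x (map (p ∷_) (shuffles π (y ∷ δ))) (map (y ∷_) (shuffles (p ∷ π) δ)) ⟩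
      ∑ (weight d) (map (x ∷_) (map (p ∷_) (shuffles π (y ∷ δ)))) + ∑ (weight d) (map (x ∷_) (map (y ∷_) (shuffles (p ∷ π) δ)))
        ≡⟨ cong₂ _+_ (∑-descent (shuffles π (y ∷ δ)) d p<x) (∑-ascent (shuffles (p ∷ π) δ) d y≮x) ⟩
      q ^ d * shift (πFirst (p ∷ π) (y ∷ δ)) d + q ^ d * δFirst (p ∷ π) (y ∷ δ) d
        ≡⟨ factor (q ^ d) _ _ ⟩
      q ^ d * (δFirst (p ∷ π) (y ∷ δ) d + shift (πFirst (p ∷ π) (y ∷ δ)) d) ∎)
      where
      open ≡-Reasoning
      factor : ∀ Q u v → Q * u + Q * v ≡ Q * (v + u)
      factor = solve-∀

    δFirst-descent : ∀ {p x y} π δ → p < x → y < x → ∀ d →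
                     q ^ d * (shift (δFirst (p ∷ π) (y ∷ δ)) d + shift (πFirst (p ∷ π) (y ∷ δ)) d) ≡ δFirst (p ∷ π) (x ∷ y ∷ δ) d
    δFirst-descent {p} {x} {y} π δ p<x y<x d = sym (begin
      δFirst (p ∷ π) (x ∷ y ∷ δ) d
        ≡⟨ ∑-map-∷-++ (weight d) x (map (p ∷_) (shuffles π (y ∷ δ))) (map (y ∷_) (shuffles (p ∷ π) δ)) ⟩
      ∑ (weight d) (map (x ∷_) (map (p ∷_) (shuffles π (y ∷ δ)))) + ∑ (weight d) (map (x ∷_) (map (y ∷_) (shuffles (p ∷ π) δ)))
        ≡⟨ cong₂ _+_ (∑-descent (shuffles π (y ∷ δ)) d p<x) (∑-descent (shuffles (p ∷ π) δ) d y<x) ⟩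
      q ^ d * shift (πFirst (p ∷ π) (y ∷ δ)) d + q ^ d * shift (δFirst (p ∷ π) (y ∷ δ)) d
        ≡⟨ factor (q ^ d) _ _ ⟩
      q ^ d * (shift (δFirst (p ∷ π) (y ∷ δ)) d + shift (πFirst (p ∷ π) (y ∷ δ)) d) ∎)
      where
      open ≡-Reasoning
      factor : ∀ Q u v → Q * u + Q * v ≡ Q * (v + u)
      factor = solve-∀

    πFirst-ascent : ∀ {p p′ x} π δ → p < x → ¬ p′ < p → ∀ d →
                    q ^ d * (πFirst (p′ ∷ π) (x ∷ δ) d + δFirst (p′ ∷ π) (x ∷ δ) d) ≡ πFirst (p ∷ p′ ∷ π) (x ∷ δ) d
    πFirst-ascent {p} {p′} {x} π δ p<x p′≮p d = sym (begin
      πFirst (p ∷ p′ ∷ π) (x ∷ δ) d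
        ≡⟨ ∑-map-∷-++ (weight d) p (map (p′ ∷_) (shuffles π (x ∷ δ))) (map (x ∷_) (shuffles (p′ ∷ π) δ)) ⟩
      ∑ (weight d) (map (p ∷_) (map (p′ ∷_) (shuffles π (x ∷ δ)))) + ∑ (weight d) (map (p ∷_) (map (x ∷_) (shuffles (p′ ∷ π) δ)))
        ≡⟨ cong₂ _+_ (∑-ascent (shuffles π (x ∷ δ)) d p′≮p) (∑-ascent (shuffles (p′ ∷ π) δ) d (ℤₚ.<-asym p<x)) ⟩
      q ^ d * πFirst (p′ ∷ π) (x ∷ δ) d + q ^ d * δFirst (p′ ∷ π) (x ∷ δ) d
        ≡⟨ ℤₚ.*-distribˡ-+ (q ^ d) _ _ ⟨
      q ^ d * (πFirst (p′ ∷ π) (x ∷ δ) d + δFirst (p′ ∷ π) (x ∷ δ) d) ∎)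
      where open ≡-Reasoning

    πFirst-descent : ∀ {p p′ x} π δ → p < x → p′ < p → ∀ d →
                     q ^ d * (shift (πFirst (p′ ∷ π) (x ∷ δ)) d + δFirst (p′ ∷ π) (x ∷ δ) d) ≡ πFirst (p ∷ p′ ∷ π) (x ∷ δ) d
    πFirst-descent {p} {p′} {x} π δ p<x p′<p d = sym (begin
      πFirst (p ∷ p′ ∷ π) (x ∷ δ) d
        ≡⟨ ∑-map-∷-++ (weight d) p (map (p′ ∷_) (shuffles π (x ∷ δ))) (map (x ∷_) (shuffles (p′ ∷ π) δ)) ⟩
      ∑ (weight d) (map (p ∷_) (map (p′ ∷_) (shuffles π (x ∷ δ)))) + ∑ (weight d) (map (p ∷_) (map (x ∷_) (shuffles (p′ ∷ π) δ)))
        ≡⟨ cong₂ _+_ (∑-descent (shuffles π (x ∷ δ)) d p′<p) (∑-ascent (shuffles (p′ ∷ π) δ) d (ℤₚ.<-asym p<x)) ⟩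
      q ^ d * shift (πFirst (p′ ∷ π) (x ∷ δ)) d + q ^ d * δFirst (p′ ∷ π) (x ∷ δ) d
        ≡⟨ ℤₚ.*-distribˡ-+ (q ^ d) _ _ ⟨
      q ^ d * (shift (πFirst (p′ ∷ π) (x ∷ δ)) d + δFirst (p′ ∷ π) (x ∷ δ) d) ∎)
      where open ≡-Reasoning

    ClosedForms : List ℤ → List ℤ → Set
    ClosedForms π δ = IsGaussProduct (δFirst π δ) (Nδ (test (last π)) π δ) (Nπ π δ) (des δ) (suc (des π)) (maj δ ℕ.+ maj π)
                    × IsGaussProduct (πFirst π δ) (Nπ π δ) (Nδ (test (last π)) π δ) (des π) (des δ) (maj δ ℕ.+ maj π)

    δFirst-step : ∀ {p x y} π δ → p < x → ClosedForms (p ∷ π) (y ∷ δ) →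
                  IsGaussProduct (δFirst (p ∷ π) (x ∷ y ∷ δ)) (Nδ (test (last (p ∷ π))) (p ∷ π) (x ∷ y ∷ δ)) (Nπ (p ∷ π) (x ∷ y ∷ δ))
                                 (des (x ∷ y ∷ δ)) (suc (des (p ∷ π))) (maj (x ∷ y ∷ δ) ℕ.+ maj (p ∷ π))
    δFirst-step {p} {x} {y} π δ p<x (hδ , hπ) with y <? x | maj-∷-+ x (y ∷ δ) (maj (p ∷ π))
    ... | no  y≮x | maj-eq = IsGaussProduct-cong (δFirst-ascent π δ p<x y≮x)
                               (cong (ℕ._+ des (p ∷ π)) (sym (ℕₚ.+-suc (bonus (test (last (p ∷ π)))) (asc (y ∷ δ))))) refl refl maj-eq
                               (IsGaussProduct-+ hδ (IsGaussProduct-shift hπ))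
    ... | yes y<x | maj-eq = IsGaussProduct-cong (δFirst-descent π δ p<x y<x)
                               refl (sym (ℕₚ.+-suc (asc (p ∷ π)) (des (y ∷ δ)))) refl maj-eq
                               (IsGaussProduct-shift-+ hδ (IsGaussProduct-shift hπ))

    πFirst-step : ∀ {p p′ x} π δ → p < x → ClosedForms (p′ ∷ π) (x ∷ δ) →
                  IsGaussProduct (πFirst (p ∷ p′ ∷ π) (x ∷ δ)) (Nπ (p ∷ p′ ∷ π) (x ∷ δ)) (Nδ (test (last (p′ ∷ π))) (p ∷ p′ ∷ π) (x ∷ δ))
                                 (des (p ∷ p′ ∷ π)) (des (x ∷ δ)) (maj (x ∷ δ) ℕ.+ maj (p ∷ p′ ∷ π))
    πFirst-step {p} {p′} {x} π δ p<x (hδ , hπ) with p′ <? p | +-maj-∷ p (p′ ∷ π) (maj (x ∷ δ))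
    ... | no  p′≮p | maj-eq = IsGaussProduct-cong (πFirst-ascent π δ p<x p′≮p)
                                refl refl refl maj-eq
                                (IsGaussProduct-+ hπ hδ)
    ... | yes p′<p | maj-eq = IsGaussProduct-cong (πFirst-descent π δ p<x p′<p)
                                refl (sym (ℕₚ.+-suc (bonus (test (last (p′ ∷ π))) ℕ.+ asc (x ∷ δ)) (des (p′ ∷ π)))) refl maj-eq
                                (IsGaussProduct-shift-+ hπ hδ)

    δFirst-base : ∀ {p x} π → p < x →
                  IsGaussProduct (δFirst (p ∷ π) (x ∷ [])) (Nδ (test (last (p ∷ π))) (p ∷ π) (x ∷ [])) (Nπ (p ∷ π) (x ∷ []))
                                 0 (suc (des (p ∷ π))) (maj (p ∷ π))
    δFirst-base {p} {x} π p<x = by-last-letter (test (last (p ∷ π))) refl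
      where
      by-last-letter : ∀ b → test (last (p ∷ π)) ≡ b →
                       IsGaussProduct (δFirst (p ∷ π) (x ∷ [])) (Nδ b (p ∷ π) (x ∷ [])) (Nπ (p ∷ π) (x ∷ [])) 0 (suc (des (p ∷ π))) (maj (p ∷ π))
      by-last-letter true  last-π = IsGaussProduct-point λ d →
        trans (ℤₚ.+-identityʳ _) (trans (weight-∷ x p π d last-π)
              (cong (λ k → q ^ (k ℕ.+ maj (p ∷ π)) when does (k ℕ.≟ d)) (des-descent π p<x)))
      by-last-letter false last-π = IsGaussProduct-zero λ d →
        trans (ℤₚ.+-identityʳ _) (weight-∷ x p π d last-π)

    πFirst-base : ∀ {p x} δ → p < x → test (last (x ∷ δ)) ≡ true →
                  IsGaussProduct (πFirst (p ∷ []) (x ∷ δ)) (Nπ (p ∷ []) (x ∷ δ)) (Nδ (test (just p)) (p ∷ []) (x ∷ δ))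
                                 0 (des (x ∷ δ)) (maj (x ∷ δ) ℕ.+ 0)
    πFirst-base {p} {x} δ p<x last-δ =
      IsGaussProduct-cong (λ _ → refl) refl refl refl (sym (ℕₚ.+-identityʳ (maj (x ∷ δ)))) (IsGaussProduct-point λ d →
        trans (ℤₚ.+-identityʳ _) (trans (weight-∷ p x δ d last-δ)
              (cong (λ k → q ^ (k ℕ.+ maj (x ∷ δ)) when does (k ℕ.≟ d)) (des-ascent δ (ℤₚ.<-asym p<x)))))

    closedForms : ∀ p π x δ → All (λ y → All (_< y) (p ∷ π)) (x ∷ δ) → test (last (x ∷ δ)) ≡ true → ClosedForms (p ∷ π) (x ∷ δ)
    closedForms p []       x []      (p<x ∷ _)   last-δ = δFirst-base [] (All.head p<x) , πFirst-base [] (All.head p<x) last-δ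
    closedForms p []       x (y ∷ δ) (p<x ∷ ord) last-δ =
      δFirst-step [] δ (All.head p<x) (closedForms p [] y δ ord last-δ) , πFirst-base (y ∷ δ) (All.head p<x) last-δ
    closedForms p (p′ ∷ π) x []      (p<x ∷ ord) last-δ =
      δFirst-base (p′ ∷ π) (All.head p<x) , πFirst-step π [] (All.head p<x) (closedForms p′ π x [] (All.tail p<x ∷ []) last-δ)
    closedForms p (p′ ∷ π) x (y ∷ δ) (p<x ∷ ord) last-δ =
      δFirst-step (p′ ∷ π) δ (All.head p<x) (closedForms p (p′ ∷ π) y δ ord last-δ) ,
      πFirst-step π (y ∷ δ) (All.head p<x) (closedForms p′ π x (y ∷ δ) (All.tail p<x ∷ All.map All.tail ord) last-δ)

  shSum≡∑shuffles : ∀ cond π δ d → Unique π → Unique δ → Disjoint π δ →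
                    shSum cond π δ d q ≡ ∑ (qMaj (cond δ) d) (shuffles π δ)
  shSum≡∑shuffles cond π δ d uπ uδ disj = begin
    foldr _+_ 0ℤ (map (λ α → q ^ maj α) (filterᵇ P W))
      ≡⟨ foldr-filterᵇ P (λ α → q ^ maj α) W ⟩
    ∑ (λ α → q ^ maj α when P α) W
      ≡⟨ ∑-cong (λ α → when-∧ (q ^ maj α) (isShuffle π δ α) (cond δ α ∧ does (des α ℕ.≟ d))) W ⟩
    ∑ (λ α → qMaj (cond δ) d α when isShuffle π δ α) W
      ≡⟨ ∑-words (Uniqueₚ.++⁺ uπ uδ disj) (qMaj (cond δ) d) _ refl (All.tabulate ∈-++⁺ˡ) (All.tabulate (∈-++⁺ʳ π)) disj ⟩
    ∑ (qMaj (cond δ) d) (shuffles π δ) ∎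
    where
    open ≡-Reasoning
    P = λ α → isShuffle π δ α ∧ cond δ α ∧ does (des α ℕ.≟ d)
    W = words (π ++ δ) (length π ℕ.+ length δ)

  shSum-condL : ∀ {p x} π δ d → p ≢ x → Unique (p ∷ π) → Unique (x ∷ δ) → Disjoint (p ∷ π) (x ∷ δ) →
                shSum condL (p ∷ π) (x ∷ δ) d q ≡ δFirst (λ _ → true) (p ∷ π) (x ∷ δ) d
  shSum-condL {p} {x} π δ d p≢x uπ uδ disj = begin
    shSum condL (p ∷ π) (x ∷ δ) d q                ≡⟨ shSum≡∑shuffles condL (p ∷ π) (x ∷ δ) d uπ uδ disj ⟩
    ∑ f (map (p ∷_) S₁ ++ map (x ∷_) S₂)          ≡⟨ ∑-++ f (map (p ∷_) S₁) (map (x ∷_) S₂) ⟩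
    ∑ f (map (p ∷_) S₁) + ∑ f (map (x ∷_) S₂)     ≡⟨ cong₂ _+_ starts-with-p starts-with-x ⟩
    0ℤ + δFirst (λ _ → true) (p ∷ π) (x ∷ δ) d     ≡⟨ ℤₚ.+-identityˡ _ ⟩
    δFirst (λ _ → true) (p ∷ π) (x ∷ δ) d          ∎
    where
    open ≡-Reasoning
    C = condL (x ∷ δ)
    f = qMaj C d
    S₁ = shuffles π (x ∷ δ)
    S₂ = shuffles (p ∷ π) δ
    starts-with-p : ∑ f (map (p ∷_) S₁) ≡ 0ℤ
    starts-with-p = trans (∑-map-cong (p ∷_) (λ β → qMaj-cong C (λ _ → false) (p ∷ β)
      (dec-false (Maybeₚ.≡-dec _≟_ (just p) (just x)) (p≢x ∘ Maybeₚ.just-injective))) S₁) (∑-zero (map (p ∷_) S₁))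
    starts-with-x : ∑ f (map (x ∷_) S₂) ≡ δFirst (λ _ → true) (p ∷ π) (x ∷ δ) d
    starts-with-x = ∑-map-cong (x ∷_) (λ β → qMaj-cong C (λ _ → true) (x ∷ β)
      (dec-true (Maybeₚ.≡-dec _≟_ (just x) (just x)) refl)) S₂

  isLastOf : List ℤ → Maybe ℤ → Bool
  isLastOf δ w = does (Maybeₚ.≡-dec _≟_ w (last δ))

  shSum-condLS : ∀ {p x} π δ d → p ≢ x → Unique (p ∷ π) → Unique (x ∷ δ) → Disjoint (p ∷ π) (x ∷ δ) →
                 shSum condLS (p ∷ π) (x ∷ δ) d q ≡ δFirst (isLastOf (x ∷ δ)) (p ∷ π) (x ∷ δ) d
  shSum-condLS {p} {x} π δ d p≢x uπ uδ disj = begin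
    shSum condLS (p ∷ π) (x ∷ δ) d q                ≡⟨ shSum≡∑shuffles condLS (p ∷ π) (x ∷ δ) d uπ uδ disj ⟩
    ∑ f (map (p ∷_) S₁ ++ map (x ∷_) S₂)           ≡⟨ ∑-++ f (map (p ∷_) S₁) (map (x ∷_) S₂) ⟩
    ∑ f (map (p ∷_) S₁) + ∑ f (map (x ∷_) S₂)      ≡⟨ cong₂ _+_ starts-with-p starts-with-x ⟩
    0ℤ + δFirst (isLastOf (x ∷ δ)) (p ∷ π) (x ∷ δ) d ≡⟨ ℤₚ.+-identityˡ _ ⟩
    δFirst (isLastOf (x ∷ δ)) (p ∷ π) (x ∷ δ) d     ∎
    where
    open ≡-Reasoning
    C = condLS (x ∷ δ)
    f = qMaj C d
    S₁ = shuffles π (x ∷ δ)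
    S₂ = shuffles (p ∷ π) δ
    starts-with-p : ∑ f (map (p ∷_) S₁) ≡ 0ℤ
    starts-with-p = trans (∑-map-cong (p ∷_) (λ β → qMaj-cong C (λ _ → false) (p ∷ β)
      (cong (_∧ isLastOf (x ∷ δ) (last (p ∷ β))) (dec-false (Maybeₚ.≡-dec _≟_ (just p) (just x)) (p≢x ∘ Maybeₚ.just-injective)))) S₁)
      (∑-zero (map (p ∷_) S₁))
    starts-with-x : ∑ f (map (x ∷_) S₂) ≡ δFirst (isLastOf (x ∷ δ)) (p ∷ π) (x ∷ δ) d
    starts-with-x = ∑-map-cong (x ∷_) (λ β → qMaj-cong C (isLastOf (x ∷ δ) ∘ last) (x ∷ β)
      (cong (_∧ isLastOf (x ∷ δ) (last (x ∷ β))) (dec-true (Maybeₚ.≡-dec _≟_ (just x) (just x)) refl))) S₂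

  shSum-condLL : ∀ {p x y} π δ d → p ≢ x → p ≢ y → ¬ y < x → Unique (p ∷ π) → Unique (x ∷ y ∷ δ) → Disjoint (p ∷ π) (x ∷ y ∷ δ) →
                 shSum condLL (p ∷ π) (x ∷ y ∷ δ) d q ≡ q ^ d * δFirst (λ _ → true) (p ∷ π) (y ∷ δ) d
  shSum-condLL {p} {x} {y} π δ d p≢x p≢y y≮x uπ uδ disj = begin
    shSum condLL (p ∷ π) (x ∷ y ∷ δ) d q
      ≡⟨ shSum≡∑shuffles condLL (p ∷ π) (x ∷ y ∷ δ) d uπ uδ disj ⟩
    ∑ f (map (p ∷_) S ++ map (x ∷_) (map (p ∷_) S₁ ++ map (y ∷_) S₂))
      ≡⟨ ∑-++ f (map (p ∷_) S) (map (x ∷_) (map (p ∷_) S₁ ++ map (y ∷_) S₂)) ⟩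
    ∑ f (map (p ∷_) S) + ∑ f (map (x ∷_) (map (p ∷_) S₁ ++ map (y ∷_) S₂))
      ≡⟨ cong (_+_ (∑ f (map (p ∷_) S))) (∑-map-∷-++ f x (map (p ∷_) S₁) (map (y ∷_) S₂)) ⟩
    ∑ f (map (p ∷_) S) + (∑ f (map (x ∷_) (map (p ∷_) S₁)) + ∑ f (map (x ∷_) (map (y ∷_) S₂)))
      ≡⟨ cong₂ (λ u v → u + (v + ∑ f (map (x ∷_) (map (y ∷_) S₂)))) starts-with-p starts-with-xp ⟩
    0ℤ + (0ℤ + ∑ f (map (x ∷_) (map (y ∷_) S₂)))
      ≡⟨ trans (ℤₚ.+-identityˡ _) (ℤₚ.+-identityˡ _) ⟩
    ∑ f (map (x ∷_) (map (y ∷_) S₂))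
      ≡⟨ starts-with-xy ⟩
    ∑ (weight (λ _ → true) d) (map (x ∷_) (map (y ∷_) S₂))
      ≡⟨ ∑-ascent (λ _ → true) S₂ d y≮x ⟩
    q ^ d * δFirst (λ _ → true) (p ∷ π) (y ∷ δ) d ∎
    where
    open ≡-Reasoning
    C  = condLL (x ∷ y ∷ δ)
    f  = qMaj C d
    S  = shuffles π (x ∷ y ∷ δ)
    S₁ = shuffles π (y ∷ δ)
    S₂ = shuffles (p ∷ π) δ
    starts-with-p : ∑ f (map (p ∷_) S) ≡ 0ℤ
    starts-with-p = trans (∑-map-cong (p ∷_) (λ β → qMaj-cong C (λ _ → false) (p ∷ β)
      (dec-false (Listₚ.≡-dec _≟_ (p ∷ take 1 β) (x ∷ y ∷ [])) (p≢x ∘ Listₚ.∷-injectiveˡ))) S) (∑-zero (map (p ∷_) S))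
    starts-with-xp : ∑ f (map (x ∷_) (map (p ∷_) S₁)) ≡ 0ℤ
    starts-with-xp = trans (∑-map₂-cong x p (λ β → qMaj-cong C (λ _ → false) (x ∷ p ∷ β)
      (dec-false (Listₚ.≡-dec _≟_ (x ∷ p ∷ []) (x ∷ y ∷ [])) (p≢y ∘ Listₚ.∷-injectiveˡ ∘ Listₚ.∷-injectiveʳ))) S₁)
      (∑-zero (map (x ∷_) (map (p ∷_) S₁)))
    starts-with-xy : ∑ f (map (x ∷_) (map (y ∷_) S₂)) ≡ ∑ (weight (λ _ → true) d) (map (x ∷_) (map (y ∷_) S₂))
    starts-with-xy = ∑-map₂-cong x y (λ β → qMaj-cong C (λ _ → true) (x ∷ y ∷ β)
      (dec-true (Listₚ.≡-dec _≟_ (x ∷ y ∷ []) (x ∷ y ∷ [])) refl)) S₂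

  Sh-l-formula : ∀ p π x δ d → Unique (p ∷ π) → Unique (x ∷ δ) → Disjoint (p ∷ π) (x ∷ δ) →
    All (λ z → All (_< z) (p ∷ π)) (x ∷ δ) →
    let r = des (x ∷ δ)
        s = des (p ∷ π)
    in shSum condL (p ∷ π) (x ∷ δ) d q * qbinDen (+ d - + r) q * qbinDen (+ d - + s - + 1) q
         ≡ qbinNum (length (x ∷ δ) ∸ r ℕ.+ s) (+ d - + r) q * qbinNum (length (p ∷ π) ∸ s ℕ.+ r ∸ 1) (+ d - + s - + 1) q
           * q ^ (maj (x ∷ δ) ℕ.+ maj (p ∷ π)) * powZ q ((+ d - + s) * (+ d - + r))
  Sh-l-formula p π x δ d uπ uδ disj above =
    trans (cong (λ S → S * qbinDen (+ d - + des (x ∷ δ)) q * qbinDen (+ d - + des (p ∷ π) - + 1) q)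
                (shSum-condL π δ d (λ { refl → disj (here refl , here refl) }) uπ uδ disj))
          (IsGaussProduct⇒qbinomial closed d)
    where
    closed : IsGaussProduct (δFirst (λ _ → true) (p ∷ π) (x ∷ δ)) (length (x ∷ δ) ∸ des (x ∷ δ) ℕ.+ des (p ∷ π))
                            (length (p ∷ π) ∸ des (p ∷ π) ℕ.+ des (x ∷ δ) ∸ 1) (des (x ∷ δ)) (suc (des (p ∷ π))) (maj (x ∷ δ) ℕ.+ maj (p ∷ π))
    closed = IsGaussProduct-cong (λ _ → refl) (Nδ-true≡ (p ∷ π) x δ) (Nπ≡ p π (x ∷ δ)) refl refl
                                 (proj₁ (closedForms (λ _ → true) p π x δ above refl))

  Sh-ls-formula : ∀ p π x δ d → Unique (p ∷ π) → Unique (x ∷ δ) → Disjoint (p ∷ π) (x ∷ δ) →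
    All (λ z → All (_< z) (p ∷ π)) (x ∷ δ) →
    let r = des (x ∷ δ)
        s = des (p ∷ π)
    in shSum condLS (p ∷ π) (x ∷ δ) d q * qbinDen (+ d - + r) q * qbinDen (+ d - + s - + 1) q
         ≡ qbinNum (length (x ∷ δ) ∸ r ℕ.+ s ∸ 1) (+ d - + r) q * qbinNum (length (p ∷ π) ∸ s ℕ.+ r ∸ 1) (+ d - + s - + 1) q
           * q ^ (maj (x ∷ δ) ℕ.+ maj (p ∷ π)) * powZ q ((+ d - + s) * (+ d - + r))
  Sh-ls-formula p π x δ d uπ uδ disj above =
    trans (cong (λ S → S * qbinDen (+ d - + des (x ∷ δ)) q * qbinDen (+ d - + des (p ∷ π) - + 1) q)
                (shSum-condLS π δ d (λ { refl → disj (here refl , here refl) }) uπ uδ disj))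
          (IsGaussProduct⇒qbinomial closed d)
    where
    π-ends-elsewhere : isLastOf (x ∷ δ) (last (p ∷ π)) ≡ false
    π-ends-elsewhere = dec-false (Maybeₚ.≡-dec _≟_ (last (p ∷ π)) (last (x ∷ δ))) (last-disjoint disj)
    δ-ends-in-δ : isLastOf (x ∷ δ) (last (x ∷ δ)) ≡ true
    δ-ends-in-δ = dec-true (Maybeₚ.≡-dec _≟_ (last (x ∷ δ)) (last (x ∷ δ))) refl
    closed : IsGaussProduct (δFirst (isLastOf (x ∷ δ)) (p ∷ π) (x ∷ δ)) (length (x ∷ δ) ∸ des (x ∷ δ) ℕ.+ des (p ∷ π) ∸ 1)
                            (length (p ∷ π) ∸ des (p ∷ π) ℕ.+ des (x ∷ δ) ∸ 1) (des (x ∷ δ)) (suc (des (p ∷ π))) (maj (x ∷ δ) ℕ.+ maj (p ∷ π))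
    closed = IsGaussProduct-cong (λ _ → refl) (trans (cong (λ b → Nδ b (p ∷ π) (x ∷ δ)) π-ends-elsewhere) (Nδ-false≡ (p ∷ π) x δ))
                                 (Nπ≡ p π (x ∷ δ)) refl refl (proj₁ (closedForms (isLastOf (x ∷ δ)) p π x δ above δ-ends-in-δ))

  Sh-ll-formula : ∀ p π x y δ d → Unique (p ∷ π) → Unique (x ∷ y ∷ δ) → Disjoint (p ∷ π) (x ∷ y ∷ δ) → x < y →
    All (λ z → All (_< z) (p ∷ π)) (x ∷ y ∷ δ) →
    let r = des (x ∷ y ∷ δ)
        s = des (p ∷ π)
    in shSum condLL (p ∷ π) (x ∷ y ∷ δ) d q * qbinDen (+ d - + r) q * qbinDen (+ d - + s - + 1) q
         ≡ qbinNum (length (x ∷ y ∷ δ) ∸ r ℕ.+ s ∸ 1) (+ d - + r) q * qbinNum (length (p ∷ π) ∸ s ℕ.+ r ∸ 1) (+ d - + s - + 1) q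
           * q ^ (maj (x ∷ y ∷ δ) ℕ.+ maj (p ∷ π)) * powZ q ((+ d - + s + + 1) * (+ d - + r))
  Sh-ll-formula p π x y δ d uπ uδ disj x<y (_ ∷ above) = begin
    shSum condLL π₀ δ₀ d q * D₁ * D₂
      ≡⟨ cong (λ S → S * D₁ * D₂) (shSum-condLL π δ d p≢x p≢y y≮x uπ uδ disj) ⟩
    q ^ d * δFirst (λ _ → true) π₀ (y ∷ δ) d * D₁ * D₂
      ≡⟨ IsGaussProduct⇒qbinomial-q^d closed d ⟩
    N₁ * N₂ * q ^ (des δ₀ ℕ.+ (maj (y ∷ δ) ℕ.+ maj π₀)) * W
      ≡⟨ cong (λ M → N₁ * N₂ * q ^ M * W) (maj-∷-+ x (y ∷ δ) (maj π₀)) ⟩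
    N₁ * N₂ * q ^ (maj δ₀ ℕ.+ maj π₀) * W ∎
    where
    open ≡-Reasoning
    π₀ = p ∷ π
    δ₀ = x ∷ y ∷ δ
    D₁ = qbinDen (+ d - + des δ₀) q
    D₂ = qbinDen (+ d - + des π₀ - + 1) q
    N₁ = qbinNum (length δ₀ ∸ des δ₀ ℕ.+ des π₀ ∸ 1) (+ d - + des δ₀) q
    N₂ = qbinNum (length π₀ ∸ des π₀ ℕ.+ des δ₀ ∸ 1) (+ d - + des π₀ - + 1) q
    W  = powZ q ((+ d - + des π₀ + + 1) * (+ d - + des δ₀))
    p≢x : p ≢ x
    p≢x refl = disj (here refl , here refl)
    p≢y : p ≢ y
    p≢y refl = disj (here refl , there (here refl))
    y≮x = ℤₚ.<-asym x<y
    des-eq : des (y ∷ δ) ≡ des δ₀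
    des-eq = sym (des-ascent δ y≮x)
    N₁-eq : Nδ true π₀ (y ∷ δ) ≡ length δ₀ ∸ des δ₀ ℕ.+ des π₀ ∸ 1
    N₁-eq = cong (λ k → k ℕ.+ des π₀ ∸ 1) (sym (trans (length∸des≡1+asc x (y ∷ δ)) (cong suc (asc-ascent δ y≮x))))
    N₂-eq : Nπ π₀ (y ∷ δ) ≡ length π₀ ∸ des π₀ ℕ.+ des δ₀ ∸ 1
    N₂-eq = trans (cong (asc π₀ ℕ.+_) des-eq) (Nπ≡ p π δ₀)
    closed : IsGaussProduct (δFirst (λ _ → true) π₀ (y ∷ δ)) (length δ₀ ∸ des δ₀ ℕ.+ des π₀ ∸ 1) (length π₀ ∸ des π₀ ℕ.+ des δ₀ ∸ 1)
                            (des δ₀) (suc (des π₀)) (maj (y ∷ δ) ℕ.+ maj π₀)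
    closed = IsGaussProduct-cong (λ _ → refl) N₁-eq N₂-eq des-eq refl (proj₁ (closedForms (λ _ → true) p π y δ above refl))

theorem3p5 : (π : List ℤ) (δ₁ δ₂ : ℤ) (δ' : List ℤ) →
  let δ = δ₁ ∷ δ₂ ∷ δ'
      m = length δ
      n = length π
      r = des δ
      s = des π
  in 1 ≤ n → Unique π → Unique δ → Disjoint π δ →
  δ₁ < δ₂ → All (λ x → All (λ y → y < x) π) δ →
  (d : ℕ) (q : ℤ) →
  let N₁ = m ∸ r ℕ.+ s
      N₁' = m ∸ r ℕ.+ s ∸ 1
      N₂ = n ∸ s ℕ.+ r ∸ 1
      k₁ = + d - + r
      k₂ = + d - + s - + 1
      base = q ^ (maj δ ℕ.+ maj π)
  in (shSum condL π δ d q * qbinDen k₁ q * qbinDen k₂ q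
        ≡ qbinNum N₁ k₁ q * qbinNum N₂ k₂ q * base * powZ q ((+ d - + s) * (+ d - + r)))
   × (shSum condLS π δ d q * qbinDen k₁ q * qbinDen k₂ q
        ≡ qbinNum N₁' k₁ q * qbinNum N₂ k₂ q * base * powZ q ((+ d - + s) * (+ d - + r)))
   × (shSum condLL π δ d q * qbinDen k₁ q * qbinDen k₂ q
        ≡ qbinNum N₁' k₁ q * qbinNum N₂ k₂ q * base * powZ q ((+ d - + s ℤ.+ + 1) * (+ d - + r)))
theorem3p5 []      δ₁ δ₂ δ' ()
theorem3p5 (p ∷ π) δ₁ δ₂ δ' _ uπ uδ disj δ₁<δ₂ above d q =
  Sh-l-formula q p π δ₁ (δ₂ ∷ δ') d uπ uδ disj above ,
  Sh-ls-formula q p π δ₁ (δ₂ ∷ δ') d uπ uδ disj above ,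
  Sh-ll-formula q p π δ₁ δ₂ δ' d uπ uδ disj δ₁<δ₂ above
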